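{- Let $m,n\ge0$. Every $w\in\mathfrak B_{m+n}$ can be written uniquely as $w=(u\times v)z$ with $u\in\mathfrak B_m$, $v\in\mathfrak S_n$, and $z^{ -1}\in(\mathfrak B)^{m,n}:=\{z\in\mathfrak B_{m+n}:0<z(1)<\cdots<z(m),\ z(m+1)<\cdots<z(m+n)\}$. Moreover, $$u=w|[1,m],\quad v=\mathrm{st}(\hat w|[m+1,m+n]),\quad u^{ -1}=\mathrm{st}^B(w^{ -1}[1,m]),\quad v^{ -1}=\mathrm{st}(w^{ -1}[m+1,m+n]).$$
   Context: $\mathfrak B_N$ is the group of signed permutations of $[N]$: bijections $w$ of $\{\pm1,\dots,\pm N\}$ with $w(-i)=-w(i)$, written in window notation $w(1)\cdots w(N)$, with product given by composition $(wz)(i)=w(z(i))$; $\mathfrak S_N\subseteq\mathfrak B_N$ are those with all $w(i)>0$. For $u\in\mathfrak B_m$, $v\in\mathfrak S_n$, $u\times v\in\mathfrak B_{m+n}$ has window $u(1),\dots,u(m),m+v(1),\dots,m+v(n)$. For a word $a=a_1\cdots a_N$ of integers: $a[i,j]=a_i\cdots a_j$; $a|[i,j]$ is the subword of letters whose absolute values lie in $[i,j]$ (reindexed as a word). $\mathrm{st}(a)$ is the unique $w\in\mathfrak S_N$ with $w(i)<w(j)\iff a_i\le a_j$ for $i<j$. With $\mathrm{Neg}(a)=\{i:a_i<0\}$, $\mathrm{st}^B(a)$ is the unique $w\in\mathfrak B_N$ with $\mathrm{Neg}(w)=\mathrm{Neg}(a)$ and, for $i<j$, $|w(i)|<|w(j)|\iff(|a_i|<|a_j|$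 or $a_i=a_j\ge0$ or $a_i=-a_j<0)$. If $\mathrm{Neg}(a)=\{i_1<\cdots<i_k\}$ and $[N]\setminus\mathrm{Neg}(a)=\{j_1<\cdots<j_{N-k}\}$, then $\hat a:=(-a_{i_k})\cdots(-a_{i_1})\,a_{j_1}\cdots a_{j_{N-k}}$. When a standardization of a word with letters in $\pm[m+1,m+n]$ or a restriction is applied, the result is regarded as a (signed) permutation after standardizing as defined. -}

module Defs where

open import Data.Nat as ℕ using (ℕ; zero; suc; _≤ᵇ_)
open import Data.Integer as ℤ using (ℤ; +_; -_; ∣_∣; _<_; _≤_; _≟_)
open import Data.Bool using (Bool; true; false; if_then_else_; _∧_)
open import Data.List using (List; []; _∷_; _++_; map; upTo; take; drop; reverse; length)
open import Data.List.Relation.Unary.All using (All)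
open import Data.List.Relation.Unary.Linked using (Linked)
open import Data.List.Relation.Binary.Permutation.Propositional using (_↭_)
open import Data.Product using (_×_)
open import Data.Sum using (_⊎_)
open import Function.Bundles using (_⇔_)
open import Relation.Nullary using (yes; no)
open import Relation.Binary.PropositionalEquality using (_≡_)

-- Words and (signed) permutations are represented by their window notation:
-- a list  w(1) ⋯ w(N)  of integers.

range1 : ℕ → List ℕ
range1 N = map suc (upTo N)

-- w ∈ 𝔅_N : the absolute values of the window form a permutation of [N]
-- (this is exactly a bijection of ±[N] commuting with negation).
IsSignedPerm : ℕ → List ℤ → Set
IsSignedPerm N w = map ∣_∣ w ↭ range1 N

IsPerm : ℕ → List ℤ → Set
IsPerm N w = IsSignedPerm N w × All (λ x → + 0 < x) w

-- 1-indexed letter a_i (0 if out of range)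
at : List ℤ → ℕ → ℤ
at [] _ = + 0
at (a ∷ as) zero = + 0
at (a ∷ as) (suc zero) = a
at (a ∷ as) (suc (suc k)) = at as (suc k)

apply : List ℤ → ℤ → ℤ
apply w (+ k) = at w k
apply w ℤ.-[1+ k ] = - at w (suc k)

compose : List ℤ → List ℤ → List ℤ
compose w z = map (apply w) z

posIn : ℤ → List ℤ → ℕ → ℤ
posIn x [] k = + 0
posIn x (a ∷ as) k with a ≟ x | a ≟ - x
... | yes _ | _ = + k
... | no _ | yes _ = - (+ k)
... | no _ | no _ = posIn x as (suc k)

inv : List ℤ → List ℤ
inv w = map (λ i → posIn (+ i) w 1) (range1 (length w))

cross : ℕ → List ℤ → List ℤ → List ℤ
cross m u v = u ++ map (λ k → + m ℤ.+ k) v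

Grass : ℕ → ℕ → List ℤ → Set
Grass m n z = IsSignedPerm (m ℕ.+ n) z
            × All (λ x → + 0 < x) (take m z)
            × Linked _<_ (take m z)
            × Linked _<_ (drop m z)

-- a[i,j] = a_i ⋯ a_j
slice : ℕ → ℕ → List ℤ → List ℤ
slice i j a = take (suc j ℕ.∸ i) (drop (i ℕ.∸ 1) a)

restrict : ℕ → ℕ → List ℤ → List ℤ
restrict i j [] = []
restrict i j (a ∷ as) =
  if (i ≤ᵇ ∣ a ∣) ∧ (∣ a ∣ ≤ᵇ j) then a ∷ restrict i j as else restrict i j as

negs : List ℤ → List ℤ
negs [] = []
negs (+ k ∷ as) = negs as
negs (ℤ.-[1+ k ] ∷ as) = ℤ.-[1+ k ] ∷ negs as

nonnegs : List ℤ → List ℤ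
nonnegs [] = []
nonnegs (+ k ∷ as) = + k ∷ nonnegs as
nonnegs (ℤ.-[1+ k ] ∷ as) = nonnegs as

hat : List ℤ → List ℤ
hat a = reverse (map -_ (negs a)) ++ nonnegs a

-- IsSt a w  :⇔  w = st(a), i.e. w ∈ 𝔖_N (N = length a) and
-- for i < j, w(i) < w(j) ⇔ a_i ≤ a_j
IsSt : List ℤ → List ℤ → Set
IsSt a w = IsPerm (length a) w
         × (∀ i j → 1 ℕ.≤ i → i ℕ.< j → j ℕ.≤ length a →
              (at w i < at w j ⇔ at a i ≤ at a j))

-- IsStB a w  :⇔  w = st^B(a), i.e. w ∈ 𝔅_N, Neg(w) = Neg(a), and for i < j,
-- |w(i)| < |w(j)| ⇔ (|a_i| < |a_j| or a_i = a_j ≥ 0 or a_i = -a_j < 0)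
IsStB : List ℤ → List ℤ → Set
IsStB a w = IsSignedPerm (length a) w
          × (∀ i → 1 ℕ.≤ i → i ℕ.≤ length a → (at w i < + 0 ⇔ at a i < + 0))
          × (∀ i j → 1 ℕ.≤ i → i ℕ.< j → j ℕ.≤ length a →
               (∣ at w i ∣ ℕ.< ∣ at w j ∣ ⇔
                 (∣ at a i ∣ ℕ.< ∣ at a j ∣
                  ⊎ (at a i ≡ at a j × + 0 ≤ at a i)
                  ⊎ (at a i ≡ - at a j × at a i < + 0))))

Factorization : ℕ → ℕ → List ℤ → List ℤ → List ℤ → List ℤ → Set
Factorization m n w u v z =
    IsSignedPerm m u × IsPerm n v × IsSignedPerm (m ℕ.+ n) z
  × Grass m n (inv z) × w ≡ compose (cross m u v) z

-- Write y = z⁻¹. From w = (u × v) z we get y(j) = w⁻¹((u × v)(j)): on the first block y records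
-- where the letters u(1), …, u(m) sit in w, on the second block where m + v(1), …, m + v(n) sit.
-- For a second factorization (u′, v′, z′) this gives, on each block, y = y′ ∘ σ for a permutation σ
-- of the block (which keeps signs on the first block, as y and y′ are positive there); since y and y′
-- increase on each block, σ is the identity, which forces u = u′, v = v′ and hence z = z′.
-- For existence take u = w|[1,m], v = ŵ|[m+1,m+n] with m subtracted from every (positive) letter,
-- and z = (u × v)⁻¹ w. Then z⁻¹ = w⁻¹ (u × v) sends the first block to the positions in w of the
-- subword u, which are positive and increasing, and the second block to w⁻¹ of a subword of ŵ, which
-- increases because ŵ lists the negative letters of w first, negated and in reverse order.
-- Finally w⁻¹ is z⁻¹ ∘ u⁻¹ on [1,m] and z⁻¹ ∘ (m + v⁻¹) on [m+1,m+n], with z⁻¹ positive and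
-- increasing on the relevant block; this yields the standardizations of u⁻¹ and v⁻¹.

module Submission where

open import Defs
open import Data.Nat using (ℕ; _+_)
open import Data.Integer using (ℤ)
open import Data.List using (List)
open import Data.Product using (Σ-syntax; _×_)
open import Relation.Binary.PropositionalEquality using (_≡_)

open import Data.Bool using (Bool; true; false; T; _∧_)
import Data.Bool.Properties as Bool
open import Data.Empty using (⊥-elim)
open import Data.Integer as ℤ using (+_; -_; ∣_∣; -[1+_]; +<+; -<+; _≟_)
import Data.Integer.Properties as ℤ
open import Data.List using ([]; _∷_; _++_; map; applyUpTo; upTo; take; drop; length; reverse; filterᵇ)
import Data.List.Properties as List
open import Data.List.Membership.Propositional using (_∈_)
open import Data.List.Membership.Propositional.Properties using (∈-map⁺; ∈-map⁻; ∈-upTo⁺; ∈-upTo⁻)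
open import Data.List.Membership.Propositional.Properties.WithK using (unique∧set⇒bag)
open import Data.List.Relation.Binary.BagAndSetEquality using (∼bag⇒↭)
open import Data.List.Relation.Binary.Permutation.Propositional
  using (_↭_; ↭-refl; ↭-sym; ↭-trans; ↭-prep; ↭⇒↭ₛ; module PermutationReasoning)
import Data.List.Relation.Binary.Permutation.Propositional.Properties as ↭
import Data.List.Relation.Binary.Permutation.Setoid.Properties as ↭ₛ
open import Data.List.Relation.Binary.Sublist.Propositional using (_⊆_; []; _∷_; _∷ʳ_)
import Data.List.Relation.Binary.Sublist.Propositional.Properties as Sublist
open import Data.List.Relation.Unary.All as All using (All; []; _∷_)
import Data.List.Relation.Unary.All.Properties as All
open import Data.List.Relation.Unary.AllPairs as AllPairs using (AllPairs; []; _∷_)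
import Data.List.Relation.Unary.AllPairs.Properties as AllPairs
open import Data.List.Relation.Unary.Any using (here; there)
open import Data.List.Relation.Unary.Linked using (Linked)
import Data.List.Relation.Unary.Linked.Properties as Linked
open import Data.List.Relation.Unary.Unique.Propositional using (Unique)
import Data.List.Relation.Unary.Unique.Propositional.Properties as Unique
open import Data.Nat as ℕ using (zero; suc; _∸_; _<_; _≤_; z≤n; s≤s; _≤ᵇ_)
import Data.Nat.Properties as ℕ
open import Data.Product using (∃-syntax; _,_; proj₁; proj₂)
open import Data.Sum using (_⊎_; inj₁; inj₂)
open import Data.Unit using (tt)
open import Function using (id; flip; _∘_; _∘′_)
open import Function.Bundles using (_⇔_; mk⇔; Equivalence)
open import Relation.Binary using (tri<; tri≈; tri>)
open import Relation.Binary.PropositionalEquality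
  using (_≢_; refl; sym; trans; cong; cong₂; subst; subst₂; setoid; module ≡-Reasoning)
open import Relation.Nullary using (¬_; yes; no)
open import Relation.Nullary.Decidable using (T?)

-- Lists

lookupᵈ : {A : Set} → A → List A → ℕ → A
lookupᵈ d []       _       = d
lookupᵈ d (x ∷ xs) zero    = x
lookupᵈ d (x ∷ xs) (suc j) = lookupᵈ d xs j

infixl 9 _‼_
_‼_ : List ℤ → ℕ → ℤ
_‼_ = lookupᵈ (+ 0)

at-suc : ∀ xs k → at xs (suc k) ≡ xs ‼ k
at-suc []       k       = refl
at-suc (a ∷ as) zero    = refl
at-suc (a ∷ as) (suc k) = at-suc as k

module _ {A : Set} (d : A) where

  lookupᵈ-∈ : ∀ xs {j} → j < length xs → lookupᵈ d xs j ∈ xs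
  lookupᵈ-∈ (x ∷ xs) {zero}  _         = here refl
  lookupᵈ-∈ (x ∷ xs) {suc j} (s≤s j<) = there (lookupᵈ-∈ xs j<)

  ∈⇒lookupᵈ : ∀ {xs a} → a ∈ xs → ∃[ j ] (j < length xs × lookupᵈ d xs j ≡ a)
  ∈⇒lookupᵈ (here refl) = zero , s≤s z≤n , refl
  ∈⇒lookupᵈ (there a∈) with j , j< , eq ← ∈⇒lookupᵈ a∈ = suc j , s≤s j< , eq

  lookupᵈ-ext : ∀ {xs ys} → length xs ≡ length ys →
                (∀ j → j < length xs → lookupᵈ d xs j ≡ lookupᵈ d ys j) → xs ≡ ys
  lookupᵈ-ext {[]}     {[]}     _   _  = refl
  lookupᵈ-ext {x ∷ xs} {y ∷ ys} len eq =
    cong₂ _∷_ (eq zero (s≤s z≤n))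
              (lookupᵈ-ext (ℕ.suc-injective len) (λ j j< → eq (suc j) (s≤s j<)))

  All⇒lookupᵈ : ∀ {P : A → Set} {xs} → All P xs → ∀ {j} → j < length xs → P (lookupᵈ d xs j)
  All⇒lookupᵈ (p ∷ _)  {zero}  _         = p
  All⇒lookupᵈ (_ ∷ ps) {suc j} (s≤s j<) = All⇒lookupᵈ ps j<

  lookupᵈ⇒All : ∀ {P : A → Set} xs → (∀ {j} → j < length xs → P (lookupᵈ d xs j)) → All P xs
  lookupᵈ⇒All []       _ = []
  lookupᵈ⇒All (x ∷ xs) p = p (s≤s z≤n) ∷ lookupᵈ⇒All xs (λ j< → p (s≤s j<))

  AllPairs⇒lookupᵈ : ∀ {R : A → A → Set} {xs} → AllPairs R xs →
                     ∀ {i j} → i < j → j < length xs → R (lookupᵈ d xs i) (lookupᵈ d xs j)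
  AllPairs⇒lookupᵈ {xs = _ ∷ xs} (r ∷ _)  {zero}  {suc j} _         (s≤s j<) = All.lookup r (lookupᵈ-∈ xs j<)
  AllPairs⇒lookupᵈ               (_ ∷ rs) {suc i} {suc j} (s≤s i<j) (s≤s j<) = AllPairs⇒lookupᵈ rs i<j j<

  lookupᵈ⇒AllPairs : ∀ {R : A → A → Set} xs →
                     (∀ {i j} → i < j → j < length xs → R (lookupᵈ d xs i) (lookupᵈ d xs j)) → AllPairs R xs
  lookupᵈ⇒AllPairs []       _ = []
  lookupᵈ⇒AllPairs (x ∷ xs) r =
    lookupᵈ⇒All xs (λ j< → r (s≤s z≤n) (s≤s j<)) ∷ lookupᵈ⇒AllPairs xs (λ i<j j< → r (s≤s i<j) (s≤s j<))

  lookupᵈ-++ˡ : ∀ xs ys {j} → j < length xs → lookupᵈ d (xs ++ ys) j ≡ lookupᵈ d xs j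
  lookupᵈ-++ˡ (x ∷ xs) ys {zero}  _         = refl
  lookupᵈ-++ˡ (x ∷ xs) ys {suc j} (s≤s j<) = lookupᵈ-++ˡ xs ys j<

  lookupᵈ-++ʳ : ∀ xs ys k → lookupᵈ d (xs ++ ys) (length xs + k) ≡ lookupᵈ d ys k
  lookupᵈ-++ʳ []       ys k = refl
  lookupᵈ-++ʳ (x ∷ xs) ys k = lookupᵈ-++ʳ xs ys k

  lookupᵈ-take : ∀ m xs {j} → j < m → lookupᵈ d (take m xs) j ≡ lookupᵈ d xs j
  lookupᵈ-take (suc m) []       _         = refl
  lookupᵈ-take (suc m) (x ∷ xs) {zero}  _ = refl
  lookupᵈ-take (suc m) (x ∷ xs) {suc j} (s≤s j<) = lookupᵈ-take m xs j<

  lookupᵈ-drop : ∀ m xs k → lookupᵈ d (drop m xs) k ≡ lookupᵈ d xs (m + k)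
  lookupᵈ-drop zero    xs       k = refl
  lookupᵈ-drop (suc m) []       k = refl
  lookupᵈ-drop (suc m) (x ∷ xs) k = lookupᵈ-drop m xs k

  lookupᵈ-applyUpTo : ∀ f n {j} → j < n → lookupᵈ d (applyUpTo f n) j ≡ f j
  lookupᵈ-applyUpTo f (suc n) {zero}  _         = refl
  lookupᵈ-applyUpTo f (suc n) {suc j} (s≤s j<) = lookupᵈ-applyUpTo (λ k → f (suc k)) n j<

module _ {A B : Set} (d : A) (e : B) (f : A → B) where

  lookupᵈ-map : ∀ xs {j} → j < length xs → lookupᵈ e (map f xs) j ≡ f (lookupᵈ d xs j)
  lookupᵈ-map (x ∷ xs) {zero}  _         = refl
  lookupᵈ-map (x ∷ xs) {suc j} (s≤s j<) = lookupᵈ-map xs j<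

  lookupᵈ-map-default : f d ≡ e → ∀ xs j → lookupᵈ e (map f xs) j ≡ f (lookupᵈ d xs j)
  lookupᵈ-map-default fd≡e []       j       = sym fd≡e
  lookupᵈ-map-default fd≡e (x ∷ xs) zero    = refl
  lookupᵈ-map-default fd≡e (x ∷ xs) (suc j) = lookupᵈ-map-default fd≡e xs j

module _ {A : Set} {R : A → A → Set} where

  AllPairs-resp-⊇ : ∀ {xs ys} → xs ⊆ ys → AllPairs R ys → AllPairs R xs
  AllPairs-resp-⊇ []          []       = []
  AllPairs-resp-⊇ (_ ∷ʳ xs⊆)  (_ ∷ rs) = AllPairs-resp-⊇ xs⊆ rs
  AllPairs-resp-⊇ (refl ∷ xs⊆) (r ∷ rs) = Sublist.All-resp-⊆ xs⊆ r ∷ AllPairs-resp-⊇ xs⊆ rs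

  AllPairs-reverse : ∀ {xs} → AllPairs (flip R) xs → AllPairs R (reverse xs)
  AllPairs-reverse {[]}     []       = []
  AllPairs-reverse {x ∷ xs} (r ∷ rs) = subst (AllPairs R) (sym (List.unfold-reverse x xs))
    (AllPairs.++⁺ (AllPairs-reverse rs) ([] ∷ [])
                  (All.map (_∷ []) (↭.All-resp-↭ (↭-sym (↭.↭-reverse xs)) r)))

module _ {A : Set} where

  take-length-++ : ∀ (xs ys : List A) → take (length xs) (xs ++ ys) ≡ xs
  take-length-++ []       ys = refl
  take-length-++ (x ∷ xs) ys = cong (x ∷_) (take-length-++ xs ys)

  drop-length-++ : ∀ (xs ys : List A) → drop (length xs) (xs ++ ys) ≡ ys
  drop-length-++ []       ys = refl
  drop-length-++ (x ∷ xs) ys = drop-length-++ xs ys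

  length-take-≤ : ∀ k (xs : List A) → k ≤ length xs → length (take k xs) ≡ k
  length-take-≤ k xs k≤ = trans (List.length-take k xs) (ℕ.m≤n⇒m⊓n≡m k≤)

  length-take-+ : ∀ {m n} (xs : List A) → length xs ≡ m + n → length (take m xs) ≡ m
  length-take-+ {m} {n} xs len = length-take-≤ m xs (subst (m ≤_) (sym len) (ℕ.m≤m+n m n))

  length-drop-+ : ∀ {m n} (xs : List A) → length xs ≡ m + n → length (drop m xs) ≡ n
  length-drop-+ {m} {n} xs len = trans (List.length-drop m xs) (trans (cong (_∸ m) len) (ℕ.m+n∸m≡n m n))

applyUpTo-+ : ∀ {A : Set} (f : ℕ → A) m n → applyUpTo f (m + n) ≡ applyUpTo f m ++ applyUpTo (λ k → f (m + k)) n
applyUpTo-+ f zero    n = refl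
applyUpTo-+ f (suc m) n = cong (f 0 ∷_) (applyUpTo-+ (λ k → f (suc k)) m n)

-- Increasing maps

distinct⇒injective : ∀ {N} (g : ℕ → ℕ) → (∀ {i j} → i < j → j < N → g i ≢ g j) →
                     ∀ {i j} → i < N → j < N → g i ≡ g j → i ≡ j
distinct⇒injective g distinct {i} {j} i<N j<N gi≡gj with ℕ.<-cmp i j
... | tri< i<j _ _ = ⊥-elim (distinct i<j j<N gi≡gj)
... | tri≈ _ i≡j _ = i≡j
... | tri> _ _ j<i = ⊥-elim (distinct j<i i<N (sym gi≡gj))

IncreasingOn : {A : Set} → (A → A → Set) → ℕ → (ℕ → A) → Set
IncreasingOn _≺_ M f = ∀ {i j} → i < j → j < M → f i ≺ f j

module _ {M : ℕ} {f : ℕ → ℕ} (f-inc : IncreasingOn _<_ M f) where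

  increasing⇒reflects-< : ∀ {i j} → i < M → j < M → f i < f j → i < j
  increasing⇒reflects-< {i} {j} i<M j<M fi<fj with ℕ.<-cmp i j
  ... | tri< i<j _ _ = i<j
  ... | tri≈ _ refl _ = ⊥-elim (ℕ.<-irrefl refl fi<fj)
  ... | tri> _ _ j<i = ⊥-elim (ℕ.<-asym fi<fj (f-inc j<i i<M))

  increasing⇒injective : ∀ {i j} → i < M → j < M → f i ≡ f j → i ≡ j
  increasing⇒injective = distinct⇒injective f (λ i<j j<M → ℕ.<⇒≢ (f-inc i<j j<M))

module _ {M : ℕ} (σ : ℕ → ℕ) (σ< : ∀ {j} → j < M → σ j < M) where

  increasing⇒≗id : IncreasingOn _<_ M σ → ∀ {j} → j < M → σ j ≡ j
  increasing⇒≗id increasing j<M = ℕ.≤-antisym (σ≤ j<M) (≤σ j<M)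
    where
    ≤σ : ∀ {j} → j < M → j ≤ σ j
    ≤σ {zero}  _     = z≤n
    ≤σ {suc j} 1+j<M = ℕ.≤-<-trans (≤σ (ℕ.<-trans (ℕ.n<1+n j) 1+j<M)) (increasing (ℕ.n<1+n j) 1+j<M)
    -- σ (j + 1), …, σ (j + d) are d distinct values above σ j
    room : ∀ d {j} → j + d < M → σ j + d < M
    room zero    {j} j<M = subst (_< M) (sym (ℕ.+-identityʳ (σ j))) (σ< (subst (_< M) (ℕ.+-identityʳ j) j<M))
    room (suc d) {j} j+1+d<M = ℕ.≤-<-trans
      (subst (_≤ σ (suc j) + d) (sym (ℕ.+-suc (σ j) d))
             (ℕ.+-monoˡ-≤ d (increasing (ℕ.n<1+n j) (ℕ.≤-<-trans (s≤s (ℕ.m≤m+n j d)) 1+j+d<M))))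
      (room d 1+j+d<M)
      where 1+j+d<M = subst (_< M) (ℕ.+-suc j d) j+1+d<M
    σ≤ : ∀ {j} → j < M → σ j ≤ j
    σ≤ {j} j<M = ℕ.+-cancelʳ-≤ (M ∸ suc j) (σ j) j
      (ℕ.≤-pred (subst (σ j + (M ∸ suc j) <_) (sym (ℕ.m+[n∸m]≡n j<M))
                       (room (M ∸ suc j) (ℕ.≤-reflexive (ℕ.m+[n∸m]≡n j<M)))))

  reindexing-increasing⇒≗id : (f g : ℕ → ℤ) →
    IncreasingOn ℤ._<_ M f → IncreasingOn ℤ._<_ M g →
    (∀ {j} → j < M → f j ≡ g (σ j)) → ∀ {j} → j < M → σ j ≡ j
  reindexing-increasing⇒≗id f g f-inc g-inc f≡g∘σ = increasing⇒≗id increasing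
    where
    increasing : IncreasingOn _<_ M σ
    increasing {i} {j} i<j j<M with ℕ.<-cmp (σ i) (σ j)
    ... | tri< σi<σj _ _ = σi<σj
    ... | tri≈ _ σi≡σj _ = ⊥-elim (ℤ.<-irrefl (trans (f≡g∘σ i<M) (trans (cong g σi≡σj) (sym (f≡g∘σ j<M))))
                                              (f-inc i<j j<M))
      where i<M = ℕ.<-trans i<j j<M
    ... | tri> _ _ σj<σi = ⊥-elim (ℤ.<-asym (f-inc i<j j<M)
                             (subst₂ ℤ._<_ (sym (f≡g∘σ j<M)) (sym (f≡g∘σ i<M)) (g-inc σj<σi (σ< i<M))))
      where i<M = ℕ.<-trans i<j j<M

-- Signed permutations

length-range1 : ∀ N → length (range1 N) ≡ N
length-range1 N = trans (List.length-map suc (upTo N)) (List.length-upTo N)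

∈-range1⁺ : ∀ {N k} → k < N → suc k ∈ range1 N
∈-range1⁺ k<N = ∈-map⁺ suc (∈-upTo⁺ k<N)

∈-range1⁻ : ∀ {N a} → a ∈ range1 N → ∃[ k ] (k < N × a ≡ suc k)
∈-range1⁻ a∈ with k , k∈ , a≡ ← ∈-map⁻ suc a∈ = k , ∈-upTo⁻ k∈ , a≡

range1-unique : ∀ N → Unique (range1 N)
range1-unique N = Unique.map⁺ ℕ.suc-injective (Unique.upTo⁺ N)

-- Positions and letters are both counted from 0: mag x j = |x(j+1)| - 1.
mag : List ℤ → ℕ → ℕ
mag x j = ∣ x ‼ j ∣ ∸ 1

record SignedPerm (N : ℕ) (x : List ℤ) : Set where
  field
    length≡        : length x ≡ N
    ∣‼∣≡suc-mag    : ∀ {j} → j < N → ∣ x ‼ j ∣ ≡ suc (mag x j)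
    mag<           : ∀ {j} → j < N → mag x j < N
    mag-injective  : ∀ {i j} → i < N → j < N → mag x i ≡ mag x j → i ≡ j
    mag-surjective : ∀ {i} → i < N → ∃[ j ] (j < N × mag x j ≡ i)

module _ {N : ℕ} {x : List ℤ} where

  private
    ∣x∣ = map ∣_∣ x

    lookup-∣x∣ : ∀ j → lookupᵈ 0 ∣x∣ j ≡ ∣ x ‼ j ∣
    lookup-∣x∣ = lookupᵈ-map-default (+ 0) 0 ∣_∣ refl x

  IsSignedPerm⇒SignedPerm : IsSignedPerm N x → SignedPerm N x
  IsSignedPerm⇒SignedPerm ∣x∣↭ = record
    { length≡ = length≡ ; ∣‼∣≡suc-mag = ∣‼∣≡suc-mag ; mag< = mag<
    ; mag-injective = distinct⇒injective (mag x) distinct ; mag-surjective = mag-surjective }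
    where
    length∣x∣ : length ∣x∣ ≡ N
    length∣x∣ = trans (↭.↭-length ∣x∣↭) (length-range1 N)
    length≡ : length x ≡ N
    length≡ = trans (sym (List.length-map ∣_∣ x)) length∣x∣
    <length : ∀ {j} → j < N → j < length ∣x∣
    <length = subst (_ <_) (sym length∣x∣)
    ∣‼∣∈range : ∀ {j} → j < N → ∃[ k ] (k < N × ∣ x ‼ j ∣ ≡ suc k)
    ∣‼∣∈range j<N with k , k<N , eq ← ∈-range1⁻ (↭.∈-resp-↭ ∣x∣↭ (lookupᵈ-∈ 0 ∣x∣ (<length j<N)))
      = k , k<N , trans (sym (lookup-∣x∣ _)) eq
    ∣‼∣≡suc-mag : ∀ {j} → j < N → ∣ x ‼ j ∣ ≡ suc (mag x j)
    ∣‼∣≡suc-mag j<N with _ , _ , eq ← ∣‼∣∈range j<N rewrite eq = refl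
    mag< : ∀ {j} → j < N → mag x j < N
    mag< j<N with _ , k<N , eq ← ∣‼∣∈range j<N rewrite eq = k<N
    unique : Unique ∣x∣
    unique = ↭ₛ.Unique-resp-↭ (setoid ℕ) (↭⇒↭ₛ (↭-sym ∣x∣↭)) (range1-unique N)
    distinct : ∀ {i j} → i < j → j < N → mag x i ≢ mag x j
    distinct i<j j<N eq = AllPairs⇒lookupᵈ 0 unique i<j (<length j<N) (begin
      lookupᵈ 0 ∣x∣ _  ≡⟨ lookup-∣x∣ _ ⟩
      ∣ x ‼ _ ∣        ≡⟨ ∣‼∣≡suc-mag (ℕ.<-trans i<j j<N) ⟩
      suc (mag x _)    ≡⟨ cong suc eq ⟩
      suc (mag x _)    ≡⟨ ∣‼∣≡suc-mag j<N ⟨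
      ∣ x ‼ _ ∣        ≡⟨ lookup-∣x∣ _ ⟨
      lookupᵈ 0 ∣x∣ _  ∎)
      where open ≡-Reasoning
    mag-surjective : ∀ {i} → i < N → ∃[ j ] (j < N × mag x j ≡ i)
    mag-surjective i<N with j , j< , eq ← ∈⇒lookupᵈ 0 (↭.∈-resp-↭ (↭-sym ∣x∣↭) (∈-range1⁺ i<N))
      = j , subst (_ <_) length∣x∣ j< , cong (_∸ 1) (trans (sym (lookup-∣x∣ j)) eq)

  SignedPerm⇒IsSignedPerm : SignedPerm N x → IsSignedPerm N x
  SignedPerm⇒IsSignedPerm s = ∼bag⇒↭ (unique∧set⇒bag unique (range1-unique N) (mk⇔ to from))
    where
    open SignedPerm s
    length∣x∣ : length ∣x∣ ≡ N
    length∣x∣ = trans (List.length-map ∣_∣ x) length≡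
    ∣x∣‼ : ∀ {j} → j < N → lookupᵈ 0 ∣x∣ j ≡ suc (mag x j)
    ∣x∣‼ j<N = trans (lookup-∣x∣ _) (∣‼∣≡suc-mag j<N)
    unique : Unique ∣x∣
    unique = lookupᵈ⇒AllPairs 0 ∣x∣ λ i<j j< eq →
      let j<N = subst (_ <_) length∣x∣ j< in
      ℕ.<⇒≢ i<j (mag-injective (ℕ.<-trans i<j j<N) j<N
                   (ℕ.suc-injective (trans (sym (∣x∣‼ (ℕ.<-trans i<j j<N))) (trans eq (∣x∣‼ j<N)))))
    to : ∀ {a} → a ∈ ∣x∣ → a ∈ range1 N
    to a∈ with j , j< , refl ← ∈⇒lookupᵈ 0 a∈ =
      let j<N = subst (_ <_) length∣x∣ j< in
      subst (_∈ range1 N) (sym (∣x∣‼ j<N)) (∈-range1⁺ (mag< j<N))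
    from : ∀ {a} → a ∈ range1 N → a ∈ ∣x∣
    from a∈ with k , k<N , refl ← ∈-range1⁻ a∈ with j , j<N , refl ← mag-surjective k<N =
      subst (_∈ ∣x∣) (∣x∣‼ j<N) (lookupᵈ-∈ 0 ∣x∣ (subst (_ <_) (sym length∣x∣) j<N))

apply-+suc : ∀ x k → apply x (+ suc k) ≡ x ‼ k
apply-+suc = at-suc

apply--[1+] : ∀ x k → apply x -[1+ k ] ≡ - (x ‼ k)
apply--[1+] x k = cong -_ (at-suc x k)

apply-+0 : ∀ x → apply x (+ 0) ≡ + 0
apply-+0 []      = refl
apply-+0 (_ ∷ _) = refl

apply-neg : ∀ x t → apply x (- t) ≡ - apply x t
apply-neg []      (+ zero)  = refl
apply-neg (_ ∷ _) (+ zero)  = refl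
apply-neg x       (+ suc k) = refl
apply-neg x       -[1+ k ]  = sym (ℤ.neg-involutive _)

∣∣≡suc⇒± : ∀ a {k} → ∣ a ∣ ≡ suc k → a ≡ + suc k ⊎ a ≡ -[1+ k ]
∣∣≡suc⇒± (+ _)    refl = inj₁ refl
∣∣≡suc⇒± -[1+ _ ] refl = inj₂ refl

data InRange (N : ℕ) : ℤ → Set where
  +inRange : ∀ {k} → k < N → InRange N (+ suc k)
  -inRange : ∀ {k} → k < N → InRange N -[1+ k ]

InRange-neg : ∀ {N t} → InRange N t → InRange N (- t)
InRange-neg (+inRange k<N) = -inRange k<N
InRange-neg (-inRange k<N) = +inRange k<N

InRange-≤ : ∀ {m N t} → m ≤ N → InRange m t → InRange N t
InRange-≤ m≤N (+inRange k<m) = +inRange (ℕ.<-≤-trans k<m m≤N)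
InRange-≤ m≤N (-inRange k<m) = -inRange (ℕ.<-≤-trans k<m m≤N)

∣∣≡suc⇒InRange : ∀ {N k} t → k < N → ∣ t ∣ ≡ suc k → InRange N t
∣∣≡suc⇒InRange (+ _)    k<N refl = +inRange k<N
∣∣≡suc⇒InRange -[1+ _ ] k<N refl = -inRange k<N

InRange-elim : ∀ {N} (P : ℤ → Set) → (∀ {k} → k < N → P (+ suc k)) → (∀ {t} → P t → P (- t)) →
               ∀ {t} → InRange N t → P t
InRange-elim P pos neg (+inRange k<N) = pos k<N
InRange-elim P pos neg (-inRange k<N) = neg (pos k<N)

odd-agree : ∀ {N} (f g : ℤ → ℤ) → (∀ t → f (- t) ≡ - f t) → (∀ t → g (- t) ≡ - g t) →
            (∀ {k} → k < N → f (+ suc k) ≡ g (+ suc k)) → ∀ {t} → InRange N t → f t ≡ g t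
odd-agree f g f-odd g-odd agree = InRange-elim (λ t → f t ≡ g t) agree
  (λ {t} eq → trans (f-odd t) (trans (cong -_ eq) (sym (g-odd t))))

‼-InRange : ∀ {N x} → SignedPerm N x → ∀ {j} → j < N → InRange N (x ‼ j)
‼-InRange s j<N = ∣∣≡suc⇒InRange _ (SignedPerm.mag< s j<N) (SignedPerm.∣‼∣≡suc-mag s j<N)

module _ (i : ℕ) where

  posIn-+ : ∀ xs k {j} → (∀ {j′} → j′ < j → ∣ xs ‼ j′ ∣ ≢ suc i) → j < length xs →
            xs ‼ j ≡ + suc i → posIn (+ suc i) xs k ≡ + (k + j)
  posIn-+ (a ∷ xs) k {zero} _ _ refl with a ≟ + suc i
  ... | yes _   = cong +_ (sym (ℕ.+-identityʳ k))
  ... | no a≢a = ⊥-elim (a≢a refl)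
  posIn-+ (a ∷ xs) k {suc j} earlier (s≤s j<) eq with a ≟ + suc i | a ≟ - + suc i
  ... | yes refl | _        = ⊥-elim (earlier (s≤s z≤n) refl)
  ... | no _     | yes refl = ⊥-elim (earlier (s≤s z≤n) refl)
  ... | no _     | no _     = trans (posIn-+ xs (suc k) (λ j′< → earlier (s≤s j′<)) j< eq)
                                    (cong +_ (sym (ℕ.+-suc k j)))

  posIn-- : ∀ xs k {j} → (∀ {j′} → j′ < j → ∣ xs ‼ j′ ∣ ≢ suc i) → j < length xs →
            xs ‼ j ≡ -[1+ i ] → posIn (+ suc i) xs k ≡ - + (k + j)
  posIn-- (a ∷ xs) k {zero} _ _ refl with a ≟ - + suc i
  ... | yes _   = cong (-_ ∘′ +_) (sym (ℕ.+-identityʳ k))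
  ... | no a≢a = ⊥-elim (a≢a refl)
  posIn-- (a ∷ xs) k {suc j} earlier (s≤s j<) eq with a ≟ + suc i | a ≟ - + suc i
  ... | yes refl | _        = ⊥-elim (earlier (s≤s z≤n) refl)
  ... | no _     | yes refl = ⊥-elim (earlier (s≤s z≤n) refl)
  ... | no _     | no _     = trans (posIn-- xs (suc k) (λ j′< → earlier (s≤s j′<)) j< eq)
                                    (cong (-_ ∘′ +_) (sym (ℕ.+-suc k j)))

inv≡applyUpTo : ∀ x → inv x ≡ applyUpTo (λ i → posIn (+ suc i) x 1) (length x)
inv≡applyUpTo x = trans (sym (List.map-∘ (upTo (length x)))) (List.map-upTo _ (length x))

length-inv : ∀ x → length (inv x) ≡ length x
length-inv x = trans (cong length (inv≡applyUpTo x)) (List.length-applyUpTo _ (length x))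

inv-‼ : ∀ x {i} → i < length x → inv x ‼ i ≡ posIn (+ suc i) x 1
inv-‼ x i< = trans (cong (_‼ _) (inv≡applyUpTo x)) (lookupᵈ-applyUpTo (+ 0) _ (length x) i<)

module Inverse {N : ℕ} {x : List ℤ} (s : SignedPerm N x) where
  open SignedPerm s

  private
    <length : ∀ {j} → j < N → j < length x
    <length = subst (_ <_) (sym length≡)

    earlier-differ : ∀ {i j} → j < N → ∣ x ‼ j ∣ ≡ suc i → ∀ {j′} → j′ < j → ∣ x ‼ j′ ∣ ≢ suc i
    earlier-differ j<N ∣xj∣ j′<j eq = ℕ.<⇒≢ j′<j
      (mag-injective (ℕ.<-trans j′<j j<N) j<N (cong (_∸ 1) (trans eq (sym ∣xj∣))))

    i<N : ∀ {i j} → j < N → ∣ x ‼ j ∣ ≡ suc i → i < N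
    i<N j<N ∣xj∣ = subst (_< N) (cong (_∸ 1) ∣xj∣) (mag< j<N)

  ‼≡+⇒inv‼ : ∀ {i j} → j < N → x ‼ j ≡ + suc i → inv x ‼ i ≡ + suc j
  ‼≡+⇒inv‼ j<N eq = let ∣xj∣ = cong ∣_∣ eq in
    trans (inv-‼ x (<length (i<N j<N ∣xj∣))) (posIn-+ _ x 1 (earlier-differ j<N ∣xj∣) (<length j<N) eq)

  ‼≡-⇒inv‼ : ∀ {i j} → j < N → x ‼ j ≡ -[1+ i ] → inv x ‼ i ≡ -[1+ j ]
  ‼≡-⇒inv‼ j<N eq = let ∣xj∣ = cong ∣_∣ eq in
    trans (inv-‼ x (<length (i<N j<N ∣xj∣))) (posIn-- _ x 1 (earlier-differ j<N ∣xj∣) (<length j<N) eq)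

  ‼-sign : ∀ {j} → j < N → x ‼ j ≡ + suc (mag x j) ⊎ x ‼ j ≡ -[1+ mag x j ]
  ‼-sign j<N = ∣∣≡suc⇒± _ (∣‼∣≡suc-mag j<N)

  inv-‼-preimage : ∀ {i} → i < N →
    ∃[ j ] (j < N × mag x j ≡ i × ∣ inv x ‼ i ∣ ≡ suc j × apply x (inv x ‼ i) ≡ + suc i)
  inv-‼-preimage i<N with j , j<N , refl ← mag-surjective i<N | ‼-sign j<N
  ... | inj₁ eq = j , j<N , refl , cong ∣_∣ inv‼ , trans (cong (apply x) inv‼) (trans (apply-+suc x j) eq)
    where inv‼ = ‼≡+⇒inv‼ j<N eq
  ... | inj₂ eq = j , j<N , refl , cong ∣_∣ inv‼ , trans (cong (apply x) inv‼) (trans (apply--[1+] x j) (cong -_ eq))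
    where inv‼ = ‼≡-⇒inv‼ j<N eq

  inv-apply : ∀ {t} → InRange N t → apply (inv x) (apply x t) ≡ t
  inv-apply = odd-agree (apply (inv x) ∘′ apply x) id
    (λ t → trans (cong (apply (inv x)) (apply-neg x t)) (apply-neg (inv x) (apply x t))) (λ _ → refl) pos
    where
    pos : ∀ {k} → k < N → apply (inv x) (apply x (+ suc k)) ≡ + suc k
    pos {k} k<N rewrite apply-+suc x k with ‼-sign k<N
    ... | inj₁ eq rewrite eq = trans (apply-+suc (inv x) _) (‼≡+⇒inv‼ k<N eq)
    ... | inj₂ eq rewrite eq = trans (apply--[1+] (inv x) _) (cong -_ (‼≡-⇒inv‼ k<N eq))

  apply-inv : ∀ {t} → InRange N t → apply x (apply (inv x) t) ≡ t
  apply-inv = odd-agree (apply x ∘′ apply (inv x)) id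
    (λ t → trans (cong (apply x) (apply-neg (inv x) t)) (apply-neg x (apply (inv x) t))) (λ _ → refl)
    (λ {k} k<N → let (_ , _ , _ , _ , eq) = inv-‼-preimage k<N in trans (cong (apply x) (apply-+suc (inv x) k)) eq)

  InRange-apply : ∀ {t} → InRange N t → InRange N (apply x t)
  InRange-apply = InRange-elim (λ t → InRange N (apply x t))
    (λ {k} k<N → subst (InRange N) (sym (apply-+suc x k)) (‼-InRange s k<N))
    (λ {t} r → subst (InRange N) (sym (apply-neg x t)) (InRange-neg r))

  inv-unique : ∀ {s t} → InRange N s → apply x s ≡ t → apply (inv x) t ≡ s
  inv-unique r refl = inv-apply r

  inv-unique′ : ∀ {s t} → InRange N s → apply (inv x) s ≡ t → apply x t ≡ s
  inv-unique′ r refl = apply-inv r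

  mag-mag-inv : ∀ {i} → i < N → mag x (mag (inv x) i) ≡ i
  mag-mag-inv i<N with _ , _ , mag≡ , eq , _ ← inv-‼-preimage i<N rewrite eq = mag≡

  inv-signedPerm : SignedPerm N (inv x)
  inv-signedPerm = record
    { length≡ = trans (length-inv x) length≡
    ; ∣‼∣≡suc-mag = λ i<N → let (_ , _ , _ , eq , _) = inv-‼-preimage i<N in
                              trans eq (cong suc (sym (cong (_∸ 1) eq)))
    ; mag< = λ i<N → let (_ , j<N , _ , eq , _) = inv-‼-preimage i<N in
                       subst (_< N) (sym (cong (_∸ 1) eq)) j<N
    ; mag-injective = injective
    ; mag-surjective = λ {j} j<N → mag x j , mag< j<N , surjective j<N }
    where
    injective : ∀ {i i′} → i < N → i′ < N → mag (inv x) i ≡ mag (inv x) i′ → i ≡ i′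
    injective i<N i′<N eq = trans (sym (mag-mag-inv i<N)) (trans (cong (mag x) eq) (mag-mag-inv i′<N))
    surjective : ∀ {j} → j < N → mag (inv x) (mag x j) ≡ j
    surjective j<N with j′ , j′<N , mag≡ , eq , _ ← inv-‼-preimage (mag< j<N) rewrite eq =
      mag-injective j′<N j<N mag≡

compose-‼ : ∀ A w j → compose A w ‼ j ≡ apply A (w ‼ j)
compose-‼ A w j = lookupᵈ-map-default (+ 0) (+ 0) (apply A) (apply-+0 A) w j

∣apply∣ : ∀ A t {k} → ∣ t ∣ ≡ suc k → ∣ apply A t ∣ ≡ ∣ A ‼ k ∣
∣apply∣ A (+ _)    refl = cong ∣_∣ (apply-+suc A _)
∣apply∣ A -[1+ k ] refl = trans (cong ∣_∣ (apply--[1+] A k)) (ℤ.∣-i∣≡∣i∣ (A ‼ k))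

apply-compose : ∀ {N} A w {t} → InRange N t → apply (compose A w) t ≡ apply A (apply w t)
apply-compose A w = odd-agree (apply (compose A w)) (apply A ∘′ apply w) (apply-neg (compose A w))
  (λ t → trans (cong (apply A) (apply-neg w t)) (apply-neg A (apply w t)))
  (λ {k} _ → trans (apply-+suc (compose A w) k)
                   (trans (compose-‼ A w k) (cong (apply A) (sym (apply-+suc w k)))))

module _ {N : ℕ} {A z : List ℤ} (sA : SignedPerm N A) (sz : SignedPerm N z) where
  private
    module A = SignedPerm sA
    module z = SignedPerm sz
    w = compose A z

    ∣w‼∣ : ∀ {j} → j < N → ∣ w ‼ j ∣ ≡ ∣ A ‼ mag z j ∣
    ∣w‼∣ {j} j<N = trans (cong ∣_∣ (compose-‼ A z j)) (∣apply∣ A (z ‼ j) (z.∣‼∣≡suc-mag j<N))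

    mag-w : ∀ {j} → j < N → mag w j ≡ mag A (mag z j)
    mag-w j<N = cong (_∸ 1) (∣w‼∣ j<N)

  compose-signedPerm : SignedPerm N (compose A z)
  compose-signedPerm = record
    { length≡ = trans (List.length-map _ z) z.length≡
    ; ∣‼∣≡suc-mag = λ j<N → trans (∣w‼∣ j<N)
        (trans (A.∣‼∣≡suc-mag (z.mag< j<N)) (cong suc (sym (mag-w j<N))))
    ; mag< = λ j<N → subst (_< N) (sym (mag-w j<N)) (A.mag< (z.mag< j<N))
    ; mag-injective = λ i<N j<N eq → z.mag-injective i<N j<N
        (A.mag-injective (z.mag< i<N) (z.mag< j<N) (trans (sym (mag-w i<N)) (trans eq (mag-w j<N))))
    ; mag-surjective = surjective }
    where
    surjective : ∀ {i} → i < N → ∃[ j ] (j < N × mag w j ≡ i)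
    surjective i<N with k , k<N , refl ← A.mag-surjective i<N
                      with j , j<N , refl ← z.mag-surjective k<N = j , j<N , mag-w j<N

  apply-inv-compose : ∀ {t} → InRange N t → apply (inv (compose A z)) t ≡ apply (inv z) (apply (inv A) t)
  apply-inv-compose {t} r = Inverse.inv-unique compose-signedPerm z⁻¹A⁻¹t-inRange (begin
    apply (compose A z) (apply (inv z) (apply (inv A) t)) ≡⟨ apply-compose A z z⁻¹A⁻¹t-inRange ⟩
    apply A (apply z (apply (inv z) (apply (inv A) t)))   ≡⟨ cong (apply A) (Inverse.apply-inv sz A⁻¹t-inRange) ⟩
    apply A (apply (inv A) t)                             ≡⟨ Inverse.apply-inv sA r ⟩
    t                                                     ∎)
    where
    open ≡-Reasoning
    A⁻¹t-inRange = Inverse.InRange-apply (Inverse.inv-signedPerm sA) r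
    z⁻¹A⁻¹t-inRange = Inverse.InRange-apply (Inverse.inv-signedPerm sz) A⁻¹t-inRange

Positive : ℕ → List ℤ → Set
Positive n v = ∀ {k} → k < n → v ‼ k ≡ + suc (mag v k)

All-positive⇒Positive : ∀ {n v} → SignedPerm n v → All (+ 0 ℤ.<_) v → Positive n v
All-positive⇒Positive sv v>0 k<n with Inverse.‼-sign sv k<n
... | inj₁ eq = eq
... | inj₂ eq with () ← subst (+ 0 ℤ.<_) eq
                     (All⇒lookupᵈ (+ 0) v>0 (subst (_ <_) (sym (SignedPerm.length≡ sv)) k<n))

Positive⇒All-positive : ∀ {n v} → SignedPerm n v → Positive n v → All (+ 0 ℤ.<_) v
Positive⇒All-positive {v = v} sv pv = lookupᵈ⇒All (+ 0) v λ k< →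
  subst (+ 0 ℤ.<_) (sym (pv (subst (_ <_) (SignedPerm.length≡ sv) k<))) (+<+ (s≤s z≤n))

inv-positive : ∀ {n v} → SignedPerm n v → Positive n v → Positive n (inv v)
inv-positive sv pv i<n with j , j<n , refl ← SignedPerm.mag-surjective sv i<n
  rewrite Inverse.‼≡+⇒inv‼ sv j<n (pv j<n) = refl

<+-split : ∀ m {n j} → j < m + n → j < m ⊎ ∃[ k ] (j ≡ m + k × k < n)
<+-split zero    {j = j}     j<n       = inj₂ (j , refl , j<n)
<+-split (suc m) {j = zero}  _         = inj₁ (s≤s z≤n)
<+-split (suc m) {j = suc j} (s≤s j<) with <+-split m j<
... | inj₁ j<m            = inj₁ (s≤s j<m)
... | inj₂ (k , refl , k<n) = inj₂ (k , refl , k<n)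

module Cross {m n : ℕ} {u v : List ℤ} (su : SignedPerm m u) (sv : SignedPerm n v) (pv : Positive n v) where
  private
    module u = SignedPerm su
    module v = SignedPerm sv

  X : List ℤ
  X = cross m u v

  X-‼-low : ∀ {j} → j < m → X ‼ j ≡ u ‼ j
  X-‼-low j<m = lookupᵈ-++ˡ (+ 0) u _ (subst (_ <_) (sym u.length≡) j<m)

  X-‼-high : ∀ {k} → k < n → X ‼ (m + k) ≡ + suc (m + mag v k)
  X-‼-high {k} k<n = begin
    X ‼ (m + k)                  ≡⟨ cong (λ l → X ‼ (l + k)) u.length≡ ⟨
    X ‼ (length u + k)           ≡⟨ lookupᵈ-++ʳ (+ 0) u _ k ⟩
    map (λ k → + m ℤ.+ k) v ‼ k
      ≡⟨ lookupᵈ-map (+ 0) (+ 0) (λ k → + m ℤ.+ k) v (subst (_ <_) (sym v.length≡) k<n) ⟩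
    + m ℤ.+ v ‼ k                ≡⟨ cong (λ k → + m ℤ.+ k) (pv k<n) ⟩
    + (m + suc (mag v k))        ≡⟨ cong +_ (ℕ.+-suc m _) ⟩
    + suc (m + mag v k)          ∎
    where open ≡-Reasoning

  mag-X-low : ∀ {j} → j < m → mag X j ≡ mag u j
  mag-X-low j<m = cong (λ a → ∣ a ∣ ∸ 1) (X-‼-low j<m)

  mag-X-high : ∀ {k} → k < n → mag X (m + k) ≡ m + mag v k
  mag-X-high k<n = cong (λ a → ∣ a ∣ ∸ 1) (X-‼-high k<n)

  cross-signedPerm : SignedPerm (m + n) X
  cross-signedPerm = record
    { length≡ = trans (List.length-++ u) (cong₂ _+_ u.length≡ (trans (List.length-map _ v) v.length≡))
    ; ∣‼∣≡suc-mag = ∣‼∣≡suc-mag ; mag< = mag<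
    ; mag-injective = mag-injective ; mag-surjective = mag-surjective }
    where
    m≤m+n = ℕ.m≤m+n m n
    ∣‼∣≡suc-mag : ∀ {j} → j < m + n → ∣ X ‼ j ∣ ≡ suc (mag X j)
    ∣‼∣≡suc-mag j< with <+-split m j<
    ... | inj₁ j<m = trans (cong ∣_∣ (X-‼-low j<m)) (trans (u.∣‼∣≡suc-mag j<m) (cong suc (sym (mag-X-low j<m))))
    ... | inj₂ (k , refl , k<n) = trans (cong ∣_∣ (X-‼-high k<n)) (cong suc (sym (mag-X-high k<n)))
    mag< : ∀ {j} → j < m + n → mag X j < m + n
    mag< j< with <+-split m j<
    ... | inj₁ j<m = subst (_< m + n) (sym (mag-X-low j<m)) (ℕ.<-≤-trans (u.mag< j<m) m≤m+n)
    ... | inj₂ (k , refl , k<n) = subst (_< m + n) (sym (mag-X-high k<n)) (ℕ.+-monoʳ-< m (v.mag< k<n))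
    low≢high : ∀ {j k} → j < m → k < n → mag X j ≢ mag X (m + k)
    low≢high j<m k<n eq = ℕ.<⇒≱ (u.mag< j<m)
      (subst (m ≤_) (trans (sym (mag-X-high k<n)) (trans (sym eq) (mag-X-low j<m))) (ℕ.m≤m+n m _))
    mag-injective : ∀ {i j} → i < m + n → j < m + n → mag X i ≡ mag X j → i ≡ j
    mag-injective i< j< eq with <+-split m i< | <+-split m j<
    ... | inj₁ i<m | inj₁ j<m =
      u.mag-injective i<m j<m (trans (sym (mag-X-low i<m)) (trans eq (mag-X-low j<m)))
    ... | inj₂ (k , refl , k<n) | inj₂ (l , refl , l<n) = cong (_+_ m) (v.mag-injective k<n l<n
      (ℕ.+-cancelˡ-≡ m _ _ (trans (sym (mag-X-high k<n)) (trans eq (mag-X-high l<n)))))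
    ... | inj₁ i<m | inj₂ (l , refl , l<n) = ⊥-elim (low≢high i<m l<n eq)
    ... | inj₂ (k , refl , k<n) | inj₁ j<m = ⊥-elim (low≢high j<m k<n (sym eq))
    mag-surjective : ∀ {i} → i < m + n → ∃[ j ] (j < m + n × mag X j ≡ i)
    mag-surjective i< with <+-split m i<
    ... | inj₁ i<m with j , j<m , refl ← u.mag-surjective i<m =
      j , ℕ.<-≤-trans j<m m≤m+n , mag-X-low j<m
    mag-surjective i< | inj₂ (a , refl , a<n) with k , k<n , refl ← v.mag-surjective a<n =
      m + k , ℕ.+-monoʳ-< m k<n , mag-X-high k<n

  private
    module X = Inverse cross-signedPerm
    module u⁻¹ = Inverse (Inverse.inv-signedPerm su)

  apply-X-low : ∀ {s} → InRange m s → apply X s ≡ apply u s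
  apply-X-low = odd-agree (apply X) (apply u) (apply-neg X) (apply-neg u)
    (λ {k} k<m → trans (apply-+suc X k) (trans (X-‼-low k<m) (sym (apply-+suc u k))))

  inv-X-‼-low : ∀ {i} → i < m → inv X ‼ i ≡ inv u ‼ i
  inv-X-‼-low {i} i<m = begin
    inv X ‼ i                    ≡⟨ apply-+suc (inv X) i ⟨
    apply (inv X) (+ suc i)      ≡⟨ X.inv-unique (InRange-≤ (ℕ.m≤m+n m n) u⁻¹i-inRange)
                                      (trans (apply-X-low u⁻¹i-inRange) (Inverse.apply-inv su (+inRange i<m))) ⟩
    apply (inv u) (+ suc i)      ≡⟨ apply-+suc (inv u) i ⟩
    inv u ‼ i                    ∎
    where
    open ≡-Reasoning
    u⁻¹i-inRange = u⁻¹.InRange-apply (+inRange i<m)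

  apply-inv-X-low : ∀ {s} → InRange m s → apply (inv X) s ≡ apply (inv u) s
  apply-inv-X-low = odd-agree (apply (inv X)) (apply (inv u)) (apply-neg (inv X)) (apply-neg (inv u))
    (λ {k} k<m → trans (apply-+suc (inv X) k) (trans (inv-X-‼-low k<m) (sym (apply-+suc (inv u) k))))

  inv-X-‼-high : ∀ {a} → a < n → inv X ‼ (m + a) ≡ + suc (m + mag (inv v) a)
  inv-X-‼-high {a} a<n = X.‼≡+⇒inv‼ (ℕ.+-monoʳ-< m b<n)
    (trans (X-‼-high b<n) (cong (λ c → + suc (m + c)) (Inverse.mag-mag-inv sv a<n)))
    where b<n = SignedPerm.mag< (Inverse.inv-signedPerm sv) a<n

inv-compose-inv : ∀ {N A w} → SignedPerm N A → SignedPerm N w → inv (compose (inv A) w) ≡ map (apply (inv w)) A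
inv-compose-inv {N} {A} {w} sA sw = lookupᵈ-ext (+ 0) lengths λ i i< →
  let i<N = subst (_ <_) (trans (length-inv z) (SignedPerm.length≡ sz)) i< in begin
    inv z ‼ i                              ≡⟨ apply-+suc (inv z) i ⟨
    apply (inv z) (+ suc i)                ≡⟨ apply-inv-compose sA⁻¹ sw (+inRange i<N) ⟩
    apply (inv w) (apply (inv (inv A)) (+ suc i))
      ≡⟨ cong (apply (inv w)) (Inverse.inv-unique sA⁻¹ (Inverse.InRange-apply sA (+inRange i<N))
                                                    (Inverse.inv-apply sA (+inRange i<N))) ⟩
    apply (inv w) (apply A (+ suc i))      ≡⟨ cong (apply (inv w)) (apply-+suc A i) ⟩
    apply (inv w) (A ‼ i)
      ≡⟨ lookupᵈ-map (+ 0) (+ 0) (apply (inv w)) A (subst (_ <_) (sym (SignedPerm.length≡ sA)) i<N) ⟨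
    map (apply (inv w)) A ‼ i              ∎
  where
  open ≡-Reasoning
  sA⁻¹ = Inverse.inv-signedPerm sA
  z = compose (inv A) w
  sz = compose-signedPerm sA⁻¹ sw
  lengths : length (inv z) ≡ length (map (apply (inv w)) A)
  lengths = trans (trans (length-inv z) (SignedPerm.length≡ sz))
                  (sym (trans (List.length-map _ A) (SignedPerm.length≡ sA)))

module Grassmannian {m n : ℕ} {y : List ℤ} (g : Grass m n y) where
  private
    y-low = proj₁ (proj₂ g)
    y-low-linked = proj₁ (proj₂ (proj₂ g))
    y-high-linked = proj₂ (proj₂ (proj₂ g))

    length-y : length y ≡ m + n
    length-y = SignedPerm.length≡ (IsSignedPerm⇒SignedPerm (proj₁ g))

  ‼-positive : ∀ {i} → i < m → + 0 ℤ.< y ‼ i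
  ‼-positive i<m = subst (+ 0 ℤ.<_) (lookupᵈ-take (+ 0) m y i<m)
    (All⇒lookupᵈ (+ 0) y-low (subst (_ <_) (sym (length-take-+ y length-y)) i<m))

  ‼-increasing-low : IncreasingOn ℤ._<_ m (y ‼_)
  ‼-increasing-low i<i′ i′<m =
    subst₂ ℤ._<_ (lookupᵈ-take (+ 0) m y (ℕ.<-trans i<i′ i′<m)) (lookupᵈ-take (+ 0) m y i′<m)
      (AllPairs⇒lookupᵈ (+ 0) (Linked.Linked⇒AllPairs ℤ.<-trans y-low-linked) i<i′
                        (subst (_ <_) (sym (length-take-+ y length-y)) i′<m))

  ‼-increasing-high : IncreasingOn ℤ._<_ n (λ a → y ‼ (m + a))
  ‼-increasing-high {a} {a′} a<a′ a′<n =
    subst₂ ℤ._<_ (lookupᵈ-drop (+ 0) m y a) (lookupᵈ-drop (+ 0) m y a′)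
      (AllPairs⇒lookupᵈ (+ 0) (Linked.Linked⇒AllPairs ℤ.<-trans y-high-linked) a<a′
                        (subst (_ <_) (sym (length-drop-+ y length-y)) a′<n))

-- Standardization

module _ {n : ℕ} {v : List ℤ} (sv : SignedPerm n v) (pv : Positive n v)
         (a : List ℤ) (F : ℕ → ℤ) (F-inc : IncreasingOn ℤ._<_ n F) (length-a : length a ≡ n)
         (a‼ : ∀ {i} → i < n → a ‼ i ≡ F (mag v i)) where
  private
    module v = SignedPerm sv

    compare-< : ∀ {i j} → i < j → j < n → (at v (suc i) ℤ.< at v (suc j) ⇔ at a (suc i) ℤ.≤ at a (suc j))
    compare-< {i} {j} i<j j<n rewrite at-suc v i | at-suc v j | at-suc a i | at-suc a j
      | pv (ℕ.<-trans i<j j<n) | pv j<n | a‼ (ℕ.<-trans i<j j<n) | a‼ j<n = mk⇔ to from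
      where
      i<n = ℕ.<-trans i<j j<n
      to : + suc (mag v i) ℤ.< + suc (mag v j) → F (mag v i) ℤ.≤ F (mag v j)
      to (+<+ (s≤s r)) = ℤ.<⇒≤ (F-inc r (v.mag< j<n))
      from : F (mag v i) ℤ.≤ F (mag v j) → + suc (mag v i) ℤ.< + suc (mag v j)
      from r with ℕ.<-cmp (mag v i) (mag v j)
      ... | tri< lt _ _ = +<+ (s≤s lt)
      ... | tri≈ _ eq _ = ⊥-elim (ℕ.<⇒≢ i<j (v.mag-injective i<n j<n eq))
      ... | tri> _ _ gt = ⊥-elim (ℤ.<⇒≱ (F-inc gt (v.mag< i<n)) r)

  IsSt-relabel : IsSt a v
  IsSt-relabel =
    (subst (λ k → IsSignedPerm k v) (sym length-a) (SignedPerm⇒IsSignedPerm sv) , Positive⇒All-positive sv pv) ,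
    λ { (suc i) (suc j) _ (s≤s i<j) j≤ → compare-< i<j (subst (_ <_) length-a j≤) }

∣∣-mono-<-positive : ∀ {a b} → + 0 ℤ.< a → a ℤ.< b → ∣ a ∣ < ∣ b ∣
∣∣-mono-<-positive {+ _} {+ _} _ (+<+ a<b) = a<b

module _ {m : ℕ} {t y : List ℤ} (st : SignedPerm m t)
         (y-pos : ∀ {k} → k < m → + 0 ℤ.< y ‼ k) (y-inc : IncreasingOn ℤ._<_ m (y ‼_))
         (a : List ℤ) (length-a : length a ≡ m) (a‼ : ∀ {i} → i < m → a ‼ i ≡ apply y (t ‼ i)) where
  private
    module t = SignedPerm st

    Y : ℕ → ℕ
    Y k = ∣ y ‼ k ∣

    Y-inc : IncreasingOn _<_ m Y
    Y-inc i<j j<m = ∣∣-mono-<-positive (y-pos (ℕ.<-trans i<j j<m)) (y-inc i<j j<m)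

    ∣a‼∣ : ∀ {i} → i < m → ∣ a ‼ i ∣ ≡ Y (mag t i)
    ∣a‼∣ i<m = trans (cong ∣_∣ (a‼ i<m)) (∣apply∣ y (t ‼ _) (t.∣‼∣≡suc-mag i<m))

    sign : ∀ {i} → i < m → (at t (suc i) ℤ.< + 0 ⇔ at a (suc i) ℤ.< + 0)
    sign {i} i<m rewrite at-suc t i | at-suc a i | a‼ i<m with Inverse.‼-sign st i<m
    ... | inj₁ eq rewrite eq | apply-+suc y (mag t i) =
      mk⇔ (λ { (+<+ ()) }) (λ y<0 → ⊥-elim (ℤ.<-asym y<0 (y-pos (t.mag< i<m))))
    ... | inj₂ eq rewrite eq | apply--[1+] y (mag t i) =
      mk⇔ (λ _ → ℤ.neg-mono-< (y-pos (t.mag< i<m))) (λ _ → -<+)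

    compare-< : ∀ {i j} → i < j → j < m →
      (∣ at t (suc i) ∣ < ∣ at t (suc j) ∣ ⇔
        (∣ at a (suc i) ∣ < ∣ at a (suc j) ∣ ⊎ (at a (suc i) ≡ at a (suc j) × + 0 ℤ.≤ at a (suc i))
                                            ⊎ (at a (suc i) ≡ - at a (suc j) × at a (suc i) ℤ.< + 0)))
    compare-< {i} {j} i<j j<m rewrite at-suc t i | at-suc t j | at-suc a i | at-suc a j
      | t.∣‼∣≡suc-mag (ℕ.<-trans i<j j<m) | t.∣‼∣≡suc-mag j<m = mk⇔ to from
      where
      i<m = ℕ.<-trans i<j j<m
      -- ∣ a(i) ∣ determines i, so the two equality alternatives of st^B never occur
      same-∣∣⇒⊥ : ∣ a ‼ i ∣ ≡ ∣ a ‼ j ∣ → suc (mag t i) < suc (mag t j)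
      same-∣∣⇒⊥ eq = ⊥-elim (ℕ.<⇒≢ i<j (t.mag-injective i<m j<m
        (increasing⇒injective Y-inc (t.mag< i<m) (t.mag< j<m) (trans (sym (∣a‼∣ i<m)) (trans eq (∣a‼∣ j<m))))))
      to : suc (mag t i) < suc (mag t j) → ∣ a ‼ i ∣ < ∣ a ‼ j ∣ ⊎ _
      to (s≤s r) = inj₁ (subst₂ _<_ (sym (∣a‼∣ i<m)) (sym (∣a‼∣ j<m)) (Y-inc r (t.mag< j<m)))
      from : ∣ a ‼ i ∣ < ∣ a ‼ j ∣ ⊎ (a ‼ i ≡ a ‼ j × + 0 ℤ.≤ a ‼ i) ⊎ (a ‼ i ≡ - a ‼ j × a ‼ i ℤ.< + 0) →
             suc (mag t i) < suc (mag t j)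
      from (inj₁ r) = s≤s (increasing⇒reflects-< Y-inc (t.mag< i<m) (t.mag< j<m)
                            (subst₂ _<_ (∣a‼∣ i<m) (∣a‼∣ j<m) r))
      from (inj₂ (inj₁ (eq , _))) = same-∣∣⇒⊥ (cong ∣_∣ eq)
      from (inj₂ (inj₂ (eq , _))) = same-∣∣⇒⊥ (trans (cong ∣_∣ eq) (ℤ.∣-i∣≡∣i∣ (a ‼ j)))

  IsStB-relabel : IsStB a t
  IsStB-relabel =
    subst (λ k → IsSignedPerm k t) (sym length-a) (SignedPerm⇒IsSignedPerm st) ,
    (λ { (suc i) _ i≤ → sign (subst (_ <_) length-a i≤) }) ,
    (λ { (suc i) (suc j) _ (s≤s i<j) j≤ → compare-< i<j (subst (_ <_) length-a j≤) })

-- Factorizations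

slice-high : ∀ m n (a : List ℤ) → slice (m + 1) (m + n) a ≡ take n (drop m a)
slice-high m n a = trans (cong (λ k → slice k (m + n) a) (ℕ.+-comm m 1)) (cong (λ k → take k (drop m a)) (ℕ.m+n∸m≡n m n))

module FactorizationFacts {m n : ℕ} {w u v z : List ℤ}
  (sw : SignedPerm (m + n) w) (F : Factorization m n w u v z) where

  su : SignedPerm m u
  su = IsSignedPerm⇒SignedPerm (proj₁ F)

  sv : SignedPerm n v
  sv = IsSignedPerm⇒SignedPerm (proj₁ (proj₁ (proj₂ F)))

  pv : Positive n v
  pv = All-positive⇒Positive sv (proj₂ (proj₁ (proj₂ F)))

  sz : SignedPerm (m + n) z
  sz = IsSignedPerm⇒SignedPerm (proj₁ (proj₂ (proj₂ F)))

  open Cross su sv pv public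
  module z⁻¹ = Grassmannian (proj₁ (proj₂ (proj₂ (proj₂ F))))

  private
    w≡X∘z : w ≡ compose X z
    w≡X∘z = proj₂ (proj₂ (proj₂ (proj₂ F)))
    module X = Inverse cross-signedPerm

  z≡X⁻¹∘w : z ≡ compose (inv X) w
  z≡X⁻¹∘w = lookupᵈ-ext (+ 0) (trans z.length≡ (sym (trans (List.length-map _ w) (SignedPerm.length≡ sw)))) λ k k< →
    let k<N = subst (_ <_) z.length≡ k< in sym (begin
      compose (inv X) w ‼ k          ≡⟨ compose-‼ (inv X) w k ⟩
      apply (inv X) (w ‼ k)          ≡⟨ cong (λ w → apply (inv X) (w ‼ k)) w≡X∘z ⟩
      apply (inv X) (compose X z ‼ k) ≡⟨ cong (apply (inv X)) (compose-‼ X z k) ⟩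
      apply (inv X) (apply X (z ‼ k)) ≡⟨ X.inv-apply (‼-InRange sz k<N) ⟩
      z ‼ k                          ∎)
    where
    open ≡-Reasoning
    module z = SignedPerm sz

  apply-inv-w : ∀ {t} → InRange (m + n) t → apply (inv w) t ≡ apply (inv z) (apply (inv X) t)
  apply-inv-w {t} r = trans (cong (λ w → apply (inv w) t) w≡X∘z) (apply-inv-compose cross-signedPerm sz r)

  inv-z-‼ : ∀ {j} → j < m + n → inv z ‼ j ≡ apply (inv w) (X ‼ j)
  inv-z-‼ {j} j<N = begin
    inv z ‼ j                                  ≡⟨ apply-+suc (inv z) j ⟨
    apply (inv z) (+ suc j)                    ≡⟨ cong (apply (inv z)) (X.inv-apply (+inRange j<N)) ⟨
    apply (inv z) (apply (inv X) (apply X (+ suc j))) ≡⟨ apply-inv-w (X.InRange-apply (+inRange j<N)) ⟨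
    apply (inv w) (apply X (+ suc j))          ≡⟨ cong (apply (inv w)) (apply-+suc X j) ⟩
    apply (inv w) (X ‼ j)                      ∎
    where open ≡-Reasoning

  private
    length-inv-w : length (inv w) ≡ m + n
    length-inv-w = trans (length-inv w) (SignedPerm.length≡ sw)

  inv-u-isStB : IsStB (slice 1 m (inv w)) (inv u)
  inv-u-isStB = IsStB-relabel (Inverse.inv-signedPerm su) z⁻¹.‼-positive z⁻¹.‼-increasing-low
    (take m (inv w)) (length-take-+ (inv w) length-inv-w) a‼
    where
    a‼ : ∀ {i} → i < m → take m (inv w) ‼ i ≡ apply (inv z) (inv u ‼ i)
    a‼ {i} i<m = begin
      take m (inv w) ‼ i                       ≡⟨ lookupᵈ-take (+ 0) m (inv w) i<m ⟩
      inv w ‼ i                                ≡⟨ apply-+suc (inv w) i ⟨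
      apply (inv w) (+ suc i)                  ≡⟨ apply-inv-w (+inRange (ℕ.<-≤-trans i<m (ℕ.m≤m+n m n))) ⟩
      apply (inv z) (apply (inv X) (+ suc i))  ≡⟨ cong (apply (inv z)) (apply-inv-X-low (+inRange i<m)) ⟩
      apply (inv z) (apply (inv u) (+ suc i))  ≡⟨ cong (apply (inv z)) (apply-+suc (inv u) i) ⟩
      apply (inv z) (inv u ‼ i)                ∎
      where open ≡-Reasoning

  inv-v-isSt : IsSt (slice (m + 1) (m + n) (inv w)) (inv v)
  inv-v-isSt = subst (λ a → IsSt a (inv v)) (sym (slice-high m n (inv w)))
    (IsSt-relabel (Inverse.inv-signedPerm sv) (inv-positive sv pv)
      (take n (drop m (inv w))) (λ b → inv z ‼ (m + b)) z⁻¹.‼-increasing-high length-a a‼)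
    where
    length-a : length (take n (drop m (inv w))) ≡ n
    length-a = length-take-≤ n (drop m (inv w)) (ℕ.≤-reflexive (sym (length-drop-+ (inv w) length-inv-w)))
    a‼ : ∀ {i} → i < n → take n (drop m (inv w)) ‼ i ≡ inv z ‼ (m + mag (inv v) i)
    a‼ {i} i<n = begin
      take n (drop m (inv w)) ‼ i                   ≡⟨ lookupᵈ-take (+ 0) n (drop m (inv w)) i<n ⟩
      drop m (inv w) ‼ i                            ≡⟨ lookupᵈ-drop (+ 0) m (inv w) i ⟩
      inv w ‼ (m + i)                               ≡⟨ apply-+suc (inv w) (m + i) ⟨
      apply (inv w) (+ suc (m + i))                 ≡⟨ apply-inv-w (+inRange (ℕ.+-monoʳ-< m i<n)) ⟩
      apply (inv z) (apply (inv X) (+ suc (m + i))) ≡⟨ cong (apply (inv z)) (apply-+suc (inv X) (m + i)) ⟩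
      apply (inv z) (inv X ‼ (m + i))               ≡⟨ cong (apply (inv z)) (inv-X-‼-high i<n) ⟩
      apply (inv z) (+ suc (m + mag (inv v) i))     ≡⟨ apply-+suc (inv z) _ ⟩
      inv z ‼ (m + mag (inv v) i)                   ∎
      where open ≡-Reasoning

positive≢negative : ∀ {a b} → + 0 ℤ.< a → + 0 ℤ.< b → b ≢ - a
positive≢negative {+ suc _}   _        () refl
positive≢negative {+ zero}    (+<+ ()) _  _

module Uniqueness {m n : ℕ} {w u v z u′ v′ z′ : List ℤ} (sw : SignedPerm (m + n) w)
  (F : Factorization m n w u v z) (F′ : Factorization m n w u′ v′ z′) where

  private
    module A = FactorizationFacts sw F
    module B = FactorizationFacts sw F′

    m≤m+n = ℕ.m≤m+n m n

    ρ : ℕ → ℤ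
    ρ j = apply (inv u′) (u ‼ j)

    ρ-inRange : ∀ {j} → j < m → InRange m (ρ j)
    ρ-inRange j<m = Inverse.InRange-apply (Inverse.inv-signedPerm B.su) (‼-InRange A.su j<m)

    z⁻¹-low : ∀ {j} → j < m → inv z ‼ j ≡ apply (inv z′) (ρ j)
    z⁻¹-low {j} j<m = begin
      inv z ‼ j                          ≡⟨ A.inv-z-‼ (ℕ.<-≤-trans j<m m≤m+n) ⟩
      apply (inv w) (A.X ‼ j)            ≡⟨ cong (apply (inv w)) (A.X-‼-low j<m) ⟩
      apply (inv w) (u ‼ j)              ≡⟨ B.apply-inv-w (InRange-≤ m≤m+n (‼-InRange A.su j<m)) ⟩
      apply (inv z′) (apply (inv B.X) (u ‼ j)) ≡⟨ cong (apply (inv z′)) (B.apply-inv-X-low (‼-InRange A.su j<m)) ⟩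
      apply (inv z′) (ρ j)               ∎
      where open ≡-Reasoning

    σ : ℕ → ℕ
    σ j = ∣ ρ j ∣ ∸ 1

    -- inv z and inv z′ are positive on the first block, so ρ j is positive (σ j is unfolded for the with)
    ρ-positive : ∀ {j} → j < m → ρ j ≡ + suc (∣ ρ j ∣ ∸ 1) × ∣ ρ j ∣ ∸ 1 < m
    ρ-positive {j} j<m with ρ j | ρ-inRange j<m | z⁻¹-low j<m
    ... | _ | +inRange k<m | _  = refl , k<m
    ... | _ | -inRange k<m | eq = ⊥-elim (positive≢negative (B.z⁻¹.‼-positive k<m) (A.z⁻¹.‼-positive j<m)
                                (trans eq (apply--[1+] (inv z′) _)))

    σ≡id : ∀ {j} → j < m → σ j ≡ j
    σ≡id = reindexing-increasing⇒≗id σ (proj₂ ∘′ ρ-positive) (inv z ‼_) (inv z′ ‼_)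
      A.z⁻¹.‼-increasing-low B.z⁻¹.‼-increasing-low
      (λ {j} j<m → trans (z⁻¹-low j<m) (trans (cong (apply (inv z′)) (proj₁ (ρ-positive j<m))) (apply-+suc (inv z′) (σ j))))

    τ : ℕ → ℕ
    τ k = mag (inv v′) (mag v k)

    τ< : ∀ {k} → k < n → τ k < n
    τ< k<n = SignedPerm.mag< (Inverse.inv-signedPerm B.sv) (SignedPerm.mag< A.sv k<n)

    z⁻¹-high : ∀ {k} → k < n → inv z ‼ (m + k) ≡ inv z′ ‼ (m + τ k)
    z⁻¹-high {k} k<n = begin
      inv z ‼ (m + k)                               ≡⟨ A.inv-z-‼ (ℕ.+-monoʳ-< m k<n) ⟩
      apply (inv w) (A.X ‼ (m + k))                 ≡⟨ cong (apply (inv w)) (A.X-‼-high k<n) ⟩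
      apply (inv w) (+ suc (m + mag v k))           ≡⟨ B.apply-inv-w (+inRange (ℕ.+-monoʳ-< m (SignedPerm.mag< A.sv k<n))) ⟩
      apply (inv z′) (apply (inv B.X) (+ suc (m + mag v k))) ≡⟨ cong (apply (inv z′)) (apply-+suc (inv B.X) (m + mag v k)) ⟩
      apply (inv z′) (inv B.X ‼ (m + mag v k))      ≡⟨ cong (apply (inv z′)) (B.inv-X-‼-high (SignedPerm.mag< A.sv k<n)) ⟩
      apply (inv z′) (+ suc (m + τ k))              ≡⟨ apply-+suc (inv z′) (m + τ k) ⟩
      inv z′ ‼ (m + τ k)                            ∎
      where open ≡-Reasoning

    τ≡id : ∀ {k} → k < n → τ k ≡ k
    τ≡id = reindexing-increasing⇒≗id τ τ< (λ k → inv z ‼ (m + k)) (λ k → inv z′ ‼ (m + k))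
      A.z⁻¹.‼-increasing-high B.z⁻¹.‼-increasing-high z⁻¹-high

  u≡u′ : u ≡ u′
  u≡u′ = lookupᵈ-ext (+ 0) (trans su.length≡ (sym su′.length≡)) λ j j< →
    let j<m = subst (_ <_) su.length≡ j< in
    sym (trans (sym (apply-+suc u′ j)) (Inverse.inv-unique′ B.su (‼-InRange A.su j<m)
          (trans (proj₁ (ρ-positive j<m)) (cong (λ i → + suc i) (σ≡id j<m)))))
    where
    module su = SignedPerm A.su
    module su′ = SignedPerm B.su

  v≡v′ : v ≡ v′
  v≡v′ = lookupᵈ-ext (+ 0) (trans sv.length≡ (sym sv′.length≡)) λ k k< →
    let k<n = subst (_ <_) sv.length≡ k< in
    trans (A.pv k<n) (trans (cong (λ i → + suc i) (mag-v≡mag-v′ k<n)) (sym (B.pv k<n)))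
    where
    module sv = SignedPerm A.sv
    module sv′ = SignedPerm B.sv
    mag-v≡mag-v′ : ∀ {k} → k < n → mag v k ≡ mag v′ k
    mag-v≡mag-v′ k<n = trans (sym (Inverse.mag-mag-inv B.sv (sv.mag< k<n))) (cong (mag v′) (τ≡id k<n))

  z≡z′ : z ≡ z′
  z≡z′ = trans A.z≡X⁻¹∘w (trans (cong (λ X → compose (inv X) w) (cong₂ (cross m) u≡u′ v≡v′)) (sym B.z≡X⁻¹∘w))

-- Existence

inBand : ℕ → ℕ → ℕ → Bool
inBand i j k = (i ≤ᵇ k) ∧ (k ≤ᵇ j)

inBand⁺ : ∀ {i j k} → i ≤ k → k ≤ j → T (inBand i j k)
inBand⁺ i≤k k≤j = Equivalence.from Bool.T-∧ (ℕ.≤⇒≤ᵇ i≤k , ℕ.≤⇒≤ᵇ k≤j)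

inBand⁻ : ∀ {i j k} → T (inBand i j k) → i ≤ k × k ≤ j
inBand⁻ {i} {j} {k} t with tᵢ , tⱼ ← Equivalence.to Bool.T-∧ t = ℕ.≤ᵇ⇒≤ i k tᵢ , ℕ.≤ᵇ⇒≤ k j tⱼ

below-band : ∀ {i j k} → k < i → ¬ T (inBand i j k)
below-band {i} {j} k<i t = ℕ.<⇒≱ k<i (proj₁ (inBand⁻ {i} {j} t))

above-band : ∀ {i j k} → j < k → ¬ T (inBand i j k)
above-band {i} {j} j<k t = ℕ.<⇒≱ j<k (proj₂ (inBand⁻ {i} {j} t))

map-∣∣-restrict : ∀ i j xs → map ∣_∣ (restrict i j xs) ≡ filterᵇ (inBand i j) (map ∣_∣ xs)
map-∣∣-restrict i j []       = refl
map-∣∣-restrict i j (a ∷ as) with inBand i j ∣ a ∣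
... | true  = cong (∣ a ∣ ∷_) (map-∣∣-restrict i j as)
... | false = map-∣∣-restrict i j as

restrict-⊆ : ∀ i j xs → restrict i j xs ⊆ xs
restrict-⊆ i j []       = []
restrict-⊆ i j (a ∷ as) with inBand i j ∣ a ∣
... | true  = refl ∷ restrict-⊆ i j as
... | false = a ∷ʳ restrict-⊆ i j as

restrict-inBand : ∀ i j xs → All (T ∘′ inBand i j ∘′ ∣_∣) (restrict i j xs)
restrict-inBand i j []       = []
restrict-inBand i j (a ∷ as) with inBand i j ∣ a ∣ in eq
... | true  = subst T (sym eq) tt ∷ restrict-inBand i j as
... | false = restrict-inBand i j as

negs-⊆ : ∀ a → negs a ⊆ a
negs-⊆ []              = []
negs-⊆ (+ k ∷ as)      = + k ∷ʳ negs-⊆ as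
negs-⊆ (-[1+ k ] ∷ as) = refl ∷ negs-⊆ as

nonnegs-⊆ : ∀ a → nonnegs a ⊆ a
nonnegs-⊆ []              = []
nonnegs-⊆ (+ k ∷ as)      = refl ∷ nonnegs-⊆ as
nonnegs-⊆ (-[1+ k ] ∷ as) = -[1+ k ] ∷ʳ nonnegs-⊆ as

negs++nonnegs↭ : ∀ a → negs a ++ nonnegs a ↭ a
negs++nonnegs↭ []              = ↭-refl
negs++nonnegs↭ (+ k ∷ as)      = ↭-trans (↭.shift (+ k) (negs as) (nonnegs as)) (↭-prep (+ k) (negs++nonnegs↭ as))
negs++nonnegs↭ (-[1+ k ] ∷ as) = ↭-prep -[1+ k ] (negs++nonnegs↭ as)

map-∣∣-hat : ∀ a → map ∣_∣ (hat a) ↭ map ∣_∣ a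
map-∣∣-hat a = begin
  map ∣_∣ (hat a)                                              ≡⟨ List.map-++ ∣_∣ (reverse (map -_ (negs a))) (nonnegs a) ⟩
  map ∣_∣ (reverse (map -_ (negs a))) ++ map ∣_∣ (nonnegs a)   ≡⟨ cong (_++ map ∣_∣ (nonnegs a)) ∣-negs∣ ⟩
  reverse (map ∣_∣ (negs a)) ++ map ∣_∣ (nonnegs a)            ↭⟨ ↭.++⁺ʳ _ (↭.↭-reverse (map ∣_∣ (negs a))) ⟩
  map ∣_∣ (negs a) ++ map ∣_∣ (nonnegs a)                      ≡⟨ List.map-++ ∣_∣ (negs a) (nonnegs a) ⟨
  map ∣_∣ (negs a ++ nonnegs a)                                ↭⟨ ↭.map⁺ ∣_∣ (negs++nonnegs↭ a) ⟩
  map ∣_∣ a                                                    ∎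
  where
  open PermutationReasoning
  ∣-negs∣ : map ∣_∣ (reverse (map -_ (negs a))) ≡ reverse (map ∣_∣ (negs a))
  ∣-negs∣ = trans (List.reverse-map ∣_∣ (map -_ (negs a)))
                  (cong reverse (trans (sym (List.map-∘ (negs a))) (List.map-cong ℤ.∣-i∣≡∣i∣ (negs a))))

hat-nonnegative : ∀ a → All (λ x → x ≡ + ∣ x ∣) (hat a)
hat-nonnegative a = All.++⁺ (↭.All-resp-↭ (↭-sym (↭.↭-reverse _)) (negated a)) (nonneg a)
  where
  negated : ∀ a → All (λ x → x ≡ + ∣ x ∣) (map -_ (negs a))
  negated []              = []
  negated (+ k ∷ as)      = negated as
  negated (-[1+ k ] ∷ as) = refl ∷ negated as
  nonneg : ∀ a → All (λ x → x ≡ + ∣ x ∣) (nonnegs a)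
  nonneg []              = []
  nonneg (+ k ∷ as)      = refl ∷ nonneg as
  nonneg (-[1+ k ] ∷ as) = nonneg as

module _ (m n : ℕ) where
  private
    range1-+ : range1 (m + n) ≡ applyUpTo suc m ++ applyUpTo (λ k → suc (m + k)) n
    range1-+ = trans (List.map-upTo suc (m + n)) (applyUpTo-+ suc m n)

  filter-inBand-range1-low : filterᵇ (inBand 1 m) (range1 (m + n)) ≡ range1 m
  filter-inBand-range1-low = begin
    filterᵇ (inBand 1 m) (range1 (m + n))                           ≡⟨ cong (filterᵇ _) range1-+ ⟩
    filterᵇ _ (applyUpTo suc m ++ applyUpTo (λ k → suc (m + k)) n)  ≡⟨ List.filter-++ (T? ∘ inBand 1 m) (applyUpTo suc m) _ ⟩
    filterᵇ _ (applyUpTo suc m) ++ filterᵇ _ (applyUpTo (λ k → suc (m + k)) n)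
      ≡⟨ cong₂ _++_ (List.filter-all (T? ∘ inBand 1 m) (All.applyUpTo⁺₁ suc m (inBand⁺ (s≤s z≤n))))
                    (List.filter-none (T? ∘ inBand 1 m)
                      (All.applyUpTo⁺₁ _ n (λ _ → above-band {1} {m} (s≤s (ℕ.m≤m+n m _))))) ⟩
    applyUpTo suc m ++ []                                           ≡⟨ List.++-identityʳ _ ⟩
    applyUpTo suc m                                                 ≡⟨ List.map-upTo suc m ⟨
    range1 m                                                        ∎
    where open ≡-Reasoning

  filter-inBand-range1-high : filterᵇ (inBand (m + 1) (m + n)) (range1 (m + n)) ≡ applyUpTo (λ k → suc (m + k)) n
  filter-inBand-range1-high = begin
    filterᵇ (inBand (m + 1) (m + n)) (range1 (m + n))               ≡⟨ cong (filterᵇ _) range1-+ ⟩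
    filterᵇ _ (applyUpTo suc m ++ applyUpTo (λ k → suc (m + k)) n)
      ≡⟨ List.filter-++ (T? ∘ inBand (m + 1) (m + n)) (applyUpTo suc m) _ ⟩
    filterᵇ _ (applyUpTo suc m) ++ filterᵇ _ (applyUpTo (λ k → suc (m + k)) n)
      ≡⟨ cong₂ _++_ (List.filter-none (T? ∘ inBand (m + 1) (m + n))
                      (All.applyUpTo⁺₁ suc m (λ k<m → below-band {m + 1} {m + n} (1+k<m+1 k<m))))
                    (List.filter-all (T? ∘ inBand (m + 1) (m + n)) (All.applyUpTo⁺₁ _ n in-band)) ⟩
    applyUpTo (λ k → suc (m + k)) n  ∎
    where
    open ≡-Reasoning
    1+k<m+1 : ∀ {k} → k < m → suc k < m + 1
    1+k<m+1 {k} k<m = subst (suc k <_) (ℕ.+-comm 1 m) (s≤s k<m)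
    in-band : ∀ {k} → k < n → T (inBand (m + 1) (m + n) (suc (m + k)))
    in-band {k} k<n = inBand⁺ (subst (_≤ suc (m + k)) (ℕ.+-comm 1 m) (s≤s (ℕ.m≤m+n m k)))
                              (subst (_≤ m + n) (ℕ.+-suc m k) (ℕ.+-monoʳ-≤ m k<n))

module Existence {m n : ℕ} {w : List ℤ} (σw : IsSignedPerm (m + n) w) where
  private
    N = m + n
    sw = IsSignedPerm⇒SignedPerm σw
    module w = SignedPerm sw

  u₀ : List ℤ
  u₀ = restrict 1 m w

  H : List ℤ
  H = restrict (m + 1) (m + n) (hat w)

  v₀ : List ℤ
  v₀ = map (λ x → + (∣ x ∣ ∸ m)) H

  u₀-signedPerm : IsSignedPerm m u₀
  u₀-signedPerm = begin
    map ∣_∣ u₀                         ≡⟨ map-∣∣-restrict 1 m w ⟩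
    filterᵇ (inBand 1 m) (map ∣_∣ w)   ↭⟨ ↭.filter-↭ (T? ∘ inBand 1 m) σw ⟩
    filterᵇ (inBand 1 m) (range1 N)    ≡⟨ filter-inBand-range1-low m n ⟩
    range1 m                           ∎
    where open PermutationReasoning

  private
    ∣H∣↭ : map ∣_∣ H ↭ applyUpTo (λ k → suc (m + k)) n
    ∣H∣↭ = begin
      map ∣_∣ H                            ≡⟨ map-∣∣-restrict (m + 1) N (hat w) ⟩
      filterᵇ band (map ∣_∣ (hat w))       ↭⟨ ↭.filter-↭ (T? ∘ band) (map-∣∣-hat w) ⟩
      filterᵇ band (map ∣_∣ w)             ↭⟨ ↭.filter-↭ (T? ∘ band) σw ⟩
      filterᵇ band (range1 N)              ≡⟨ filter-inBand-range1-high m n ⟩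
      applyUpTo (λ k → suc (m + k)) n      ∎
      where
      open PermutationReasoning
      band = inBand (m + 1) N

    H-letters : All (λ x → x ≡ + ∣ x ∣ × m < ∣ x ∣) H
    H-letters = All.zipWith id
      ( Sublist.All-resp-⊆ (restrict-⊆ (m + 1) N (hat w)) (hat-nonnegative w)
      , All.map (λ {x} t → subst (_≤ ∣ x ∣) (ℕ.+-comm m 1) (proj₁ (inBand⁻ {m + 1} {N} t)))
                (restrict-inBand (m + 1) N (hat w)) )

  v₀-signedPerm : IsSignedPerm n v₀
  v₀-signedPerm = begin
    map ∣_∣ v₀                                   ≡⟨ List.map-∘ H ⟨
    map (λ x → ∣ x ∣ ∸ m) H                      ≡⟨ List.map-∘ H ⟩
    map (_∸ m) (map ∣_∣ H)                       ↭⟨ ↭.map⁺ (_∸ m) ∣H∣↭ ⟩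
    map (_∸ m) (applyUpTo (λ k → suc (m + k)) n) ≡⟨ List.map-applyUpTo _ (_∸ m) n ⟩
    applyUpTo (λ k → suc (m + k) ∸ m) n          ≡⟨ List.map-upTo _ n ⟨
    map (λ k → suc (m + k) ∸ m) (upTo n)
      ≡⟨ List.map-cong (λ k → trans (cong (_∸ m) (sym (ℕ.+-suc m k))) (ℕ.m+n∸m≡n m (suc k))) (upTo n) ⟩
    range1 n                                     ∎
    where open PermutationReasoning

  v₀-positive : All (+ 0 ℤ.<_) v₀
  v₀-positive = All.map⁺ (All.map (λ (_ , m<) → +<+ (ℕ.m<n⇒0<n∸m m<)) H-letters)

  H≡shift-v₀ : H ≡ map (λ k → + m ℤ.+ k) v₀
  H≡shift-v₀ = sym (trans (sym (List.map-∘ H)) (List.map-id-local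
    (All.map (λ (x≡ , m<) → trans (cong +_ (ℕ.m+[n∸m]≡n (ℕ.<⇒≤ m<))) (sym x≡)) H-letters)))

  su : SignedPerm m u₀
  su = IsSignedPerm⇒SignedPerm u₀-signedPerm

  sv : SignedPerm n v₀
  sv = IsSignedPerm⇒SignedPerm v₀-signedPerm

  pv : Positive n v₀
  pv = All-positive⇒Positive sv v₀-positive

  open Cross su sv pv public

  z₀ : List ℤ
  z₀ = compose (inv X) w

  z₀-signedPerm : SignedPerm N z₀
  z₀-signedPerm = compose-signedPerm (Inverse.inv-signedPerm cross-signedPerm) sw

  w≡X∘z₀ : w ≡ compose X z₀
  w≡X∘z₀ = lookupᵈ-ext (+ 0) (trans w.length≡ (sym (trans (List.length-map _ z₀) (SignedPerm.length≡ z₀-signedPerm))))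
    λ j j< → sym (begin
      compose X z₀ ‼ j              ≡⟨ compose-‼ X z₀ j ⟩
      apply X (z₀ ‼ j)              ≡⟨ cong (apply X) (compose-‼ (inv X) w j) ⟩
      apply X (apply (inv X) (w ‼ j)) ≡⟨ Inverse.apply-inv cross-signedPerm (‼-InRange sw (subst (_ <_) w.length≡ j<)) ⟩
      w ‼ j                         ∎)
    where open ≡-Reasoning

  inv-z₀≡ : inv z₀ ≡ map (apply (inv w)) u₀ ++ map (apply (inv w)) H
  inv-z₀≡ = begin
    inv z₀                                                 ≡⟨ inv-compose-inv cross-signedPerm sw ⟩
    map (apply (inv w)) X                                  ≡⟨ List.map-++ (apply (inv w)) u₀ _ ⟩
    map (apply (inv w)) u₀ ++ map (apply (inv w)) (map (λ k → + m ℤ.+ k) v₀)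
      ≡⟨ cong (λ h → map (apply (inv w)) u₀ ++ map (apply (inv w)) h) H≡shift-v₀ ⟨
    map (apply (inv w)) u₀ ++ map (apply (inv w)) H        ∎
    where open ≡-Reasoning

  private
    g : ℤ → ℤ
    g = apply (inv w)

    map-g-w : map g w ≡ applyUpTo (λ j → + suc j) N
    map-g-w = lookupᵈ-ext (+ 0) lengths λ j j< →
      let j<N = subst (_ <_) (trans (List.length-map g w) w.length≡) j< in begin
        map g w ‼ j            ≡⟨ lookupᵈ-map (+ 0) (+ 0) g w (subst (_ <_) (sym w.length≡) j<N) ⟩
        g (w ‼ j)              ≡⟨ cong g (apply-+suc w j) ⟨
        g (apply w (+ suc j))  ≡⟨ Inverse.inv-apply sw (+inRange j<N) ⟩
        + suc j                ≡⟨ lookupᵈ-applyUpTo (+ 0) (λ j → + suc j) N j<N ⟨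
        applyUpTo (λ j → + suc j) N ‼ j ∎
      where
      open ≡-Reasoning
      lengths = trans (trans (List.length-map g w) w.length≡) (sym (List.length-applyUpTo _ N))

    g-increasing : ∀ {xs} → xs ⊆ w → AllPairs ℤ._<_ (map g xs)
    g-increasing xs⊆w = AllPairs-resp-⊇ (Sublist.map⁺ g xs⊆w)
      (subst (AllPairs ℤ._<_) (sym map-g-w) (AllPairs.applyUpTo⁺₁ _ N (λ i<j _ → +<+ (s≤s i<j))))

    g-positive : ∀ {xs} → xs ⊆ w → All (+ 0 ℤ.<_) (map g xs)
    g-positive xs⊆w = Sublist.All-resp-⊆ (Sublist.map⁺ g xs⊆w)
      (subst (All (+ 0 ℤ.<_)) (sym map-g-w) (All.applyUpTo⁺₁ _ N (λ _ → +<+ (s≤s z≤n))))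

    map-g-hat : map g (hat w) ≡ reverse (map -_ (map g (negs w))) ++ map g (nonnegs w)
    map-g-hat = trans (List.map-++ g (reverse (map -_ (negs w))) (nonnegs w))
      (cong (_++ map g (nonnegs w)) (trans (List.reverse-map g (map -_ (negs w))) (cong reverse
        (trans (sym (List.map-∘ (negs w))) (trans (List.map-cong (apply-neg (inv w)) (negs w)) (List.map-∘ (negs w)))))))

    -- the first part of hat w is the negatives of a subword of w, reversed
    g-hat-increasing : AllPairs ℤ._<_ (map g (hat w))
    g-hat-increasing = subst (AllPairs ℤ._<_) (sym map-g-hat)
      (AllPairs.++⁺ negatives-increasing (g-increasing (nonnegs-⊆ w)) negatives<positives)
      where
      negatives = reverse (map -_ (map g (negs w)))
      negatives-increasing : AllPairs ℤ._<_ negatives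
      negatives-increasing = AllPairs-reverse (AllPairs.map⁺ (AllPairs.map ℤ.neg-mono-< (g-increasing (negs-⊆ w))))
      negatives<0 : All (ℤ._< + 0) negatives
      negatives<0 = ↭.All-resp-↭ (↭-sym (↭.↭-reverse _)) (All.map⁺ (All.map ℤ.neg-mono-< (g-positive (negs-⊆ w))))
      negatives<positives : All (λ x → All (x ℤ.<_) (map g (nonnegs w))) negatives
      negatives<positives = All.map (λ x<0 → All.map (ℤ.<-trans x<0) (g-positive (nonnegs-⊆ w))) negatives<0

  grass : Grass m n (inv z₀)
  grass = SignedPerm⇒IsSignedPerm (Inverse.inv-signedPerm z₀-signedPerm)
        , subst (All (+ 0 ℤ.<_)) (sym take≡) (g-positive (restrict-⊆ 1 m w))
        , subst (Linked ℤ._<_) (sym take≡) (Linked.AllPairs⇒Linked (g-increasing (restrict-⊆ 1 m w)))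
        , subst (Linked ℤ._<_) (sym drop≡)
            (Linked.AllPairs⇒Linked (AllPairs-resp-⊇ (Sublist.map⁺ g (restrict-⊆ (m + 1) N (hat w))) g-hat-increasing))
    where
    length-g-u₀ : length (map g u₀) ≡ m
    length-g-u₀ = trans (List.length-map g u₀) (SignedPerm.length≡ su)
    take≡ : take m (inv z₀) ≡ map g u₀
    take≡ = trans (cong (take m) inv-z₀≡)
      (subst (λ k → take k (map g u₀ ++ map g H) ≡ map g u₀) length-g-u₀ (take-length-++ (map g u₀) (map g H)))
    drop≡ : drop m (inv z₀) ≡ map g H
    drop≡ = trans (cong (drop m) inv-z₀≡)
      (subst (λ k → drop k (map g u₀ ++ map g H) ≡ map g H) length-g-u₀ (drop-length-++ (map g u₀) (map g H)))

  factorization : Factorization m n w u₀ v₀ z₀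
  factorization = u₀-signedPerm , (v₀-signedPerm , v₀-positive) , SignedPerm⇒IsSignedPerm z₀-signedPerm , grass , w≡X∘z₀

  v₀-isSt : IsSt H v₀
  v₀-isSt = IsSt-relabel sv pv H (λ b → + (m + suc b)) (λ b<b′ _ → +<+ (ℕ.+-monoʳ-< m (s≤s b<b′))) length-H H‼
    where
    length-H : length H ≡ n
    length-H = trans (cong length H≡shift-v₀) (trans (List.length-map _ v₀) (SignedPerm.length≡ sv))
    H‼ : ∀ {i} → i < n → H ‼ i ≡ + (m + suc (mag v₀ i))
    H‼ {i} i<n = trans (cong (_‼ i) H≡shift-v₀)
      (trans (lookupᵈ-map (+ 0) (+ 0) _ v₀ (subst (_ <_) (sym (SignedPerm.length≡ sv)) i<n)) (cong (λ k → + m ℤ.+ k) (pv i<n)))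

proposition4p1 : (m n : ℕ) (w : List ℤ) → IsSignedPerm (m + n) w →
    Σ[ u ∈ List ℤ ] Σ[ v ∈ List ℤ ] Σ[ z ∈ List ℤ ]
      ( Factorization m n w u v z
      × (∀ u′ v′ z′ → Factorization m n w u′ v′ z′ → u′ ≡ u × v′ ≡ v × z′ ≡ z)
      × u ≡ restrict 1 m w
      × IsSt (restrict (m + 1) (m + n) (hat w)) v
      × IsStB (slice 1 m (inv w)) (inv u)
      × IsSt (slice (m + 1) (m + n) (inv w)) (inv v) )
proposition4p1 m n w σw =
  u₀ , v₀ , z₀ , factorization , unique , refl , v₀-isSt , inv-u-isStB , inv-v-isSt
  where
  open Existence {m} {n} σw
  sw = IsSignedPerm⇒SignedPerm σw
  open FactorizationFacts sw factorization using (inv-u-isStB; inv-v-isSt)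
  unique : ∀ u′ v′ z′ → Factorization m n w u′ v′ z′ → u′ ≡ u₀ × v′ ≡ v₀ × z′ ≡ z₀
  unique u′ v′ z′ F′ = u≡u′ , v≡v′ , z≡z′
    where open Uniqueness sw F′ factorization
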